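{- For every integer $r\ge 2$ there exists $\delta=\delta(r)>0$ such that if $u\ge 1$, $m\ge 2r$ and $um^r\le n^r$, then \[\Pr\left(\mathcal{N}(K_r,G_{u,m,n})>\delta u m^r\right)>\delta.\]
   Context: For a real $u$ and integers $m\le n$, the random clique graph $G_{u,m,n}$ is defined as follows: let $C_1,\dots,C_{\binom{n}{m}}$ enumerate the $m$-element subsets of $[n]$, and let $B_1,\dots,B_{\binom nm}$ be i.i.d. Bernoulli random variables with success probability $u\binom{n}{m}^{ -1}$. Then $G_{u,m,n}$ is the graph on $[n]$ with edge set $\bigcup_{i:B_i=1}\binom{C_i}{2}$, i.e. the union of the cliques on the selected sets $C_i$. $\mathcal{N}(K_r,G)$ denotes the number of copies of $K_r$ in $G$.
   Formalization: The parameter u of $G_{u,m,n}$ ranges over the rationals rather than the reals. -}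

module Defs where

open import Data.Bool using (Bool; true; false; _∧_; _∨_; not; if_then_else_)
open import Data.Nat as ℕ using (ℕ; zero; suc; _≡ᵇ_)
open import Data.Nat.Combinatorics using (_C_)
open import Data.Fin using (Fin)
open import Data.Fin.Properties using () renaming (_≟_ to _≟ᶠ_)
open import Data.List as List using (List; []; _∷_; _++_; map; length)
open import Data.Vec as Vec using (Vec; []; _∷_; lookup)
open import Data.Vec.Functional using () renaming (Vector to FVec)
open import Data.Integer using (+_)
open import Data.Rational using (ℚ; 0ℚ; 1ℚ; _/_; _*_; _+_; _-_; _≤ᵇ_)
open import Relation.Nullary.Decidable using (⌊_⌋)

-- all subsets of [n] = Fin n, as characteristic vectors
subsets : (n : ℕ) → List (Vec Bool n)
subsets zero    = [] ∷ []
subsets (suc n) = map (false ∷_) (subsets n) ++ map (true ∷_) (subsets n)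

card : ∀ {n} → Vec Bool n → ℕ
card []          = 0
card (false ∷ s) = card s
card (true ∷ s)  = suc (card s)

filterᵇ : ∀ {A : Set} → (A → Bool) → List A → List A
filterᵇ p []       = []
filterᵇ p (x ∷ xs) = if p x then x ∷ filterᵇ p xs else filterᵇ p xs

mSubsets : (n m : ℕ) → List (Vec Bool n)
mSubsets n m = filterᵇ (λ s → card s ≡ᵇ m) (subsets n)

cliqueSets : (n m : ℕ) → Vec (Vec Bool n) (length (mSubsets n m))
cliqueSets n m = Vec.fromList (mSubsets n m)

anyᵇ : ∀ {k} → Vec Bool k → Bool
anyᵇ []       = false
anyᵇ (b ∷ bs) = b ∨ anyᵇ bs

allᵇ : ∀ {k} → (Fin k → Bool) → Bool
allᵇ {zero}  f = true
allᵇ {suc k} f = f Fin.zero ∧ allᵇ (λ i → f (Fin.suc i))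
  where import Data.Fin as Fin

-- A graph on [n] given by its (symmetric) adjacency predicate
Graph : ℕ → Set
Graph n = Fin n → Fin n → Bool

-- Union of the cliques on the selected sets C_i (selection B : Vec Bool L)
unionOfCliques : ∀ {n L} → Vec (Vec Bool n) L → Vec Bool L → Graph n
unionOfCliques Cs B i j =
  not ⌊ i ≟ᶠ j ⌋ ∧ anyᵇ (Vec.zipWith (λ b X → b ∧ lookup X i ∧ lookup X j) B Cs)

isClique : ∀ {n} → Graph n → Vec Bool n → Bool
isClique G S = allᵇ (λ i → allᵇ (λ j →
  not (lookup S i ∧ lookup S j ∧ not ⌊ i ≟ᶠ j ⌋) ∨ G i j))

-- N(K_r, G): number of copies of K_r in G (= number of r-subsets spanning a clique)
numKr : ∀ {n} → ℕ → Graph n → ℕ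
numKr {n} r G = length (filterᵇ (isClique G) (mSubsets n r))

ℕtoℚ : ℕ → ℚ
ℕtoℚ k = + k / 1

-- 1/k, with the (irrelevant) convention 1/0 = 0
invℕ : ℕ → ℚ
invℕ zero    = 0ℚ
invℕ (suc k) = + 1 / suc k

-- probability of outcome B for i.i.d. Bernoulli(p) coordinates
weight : ∀ {L} → ℚ → Vec Bool L → ℚ
weight p []       = 1ℚ
weight p (b ∷ bs) = (if b then p else (1ℚ - p)) * weight p bs

sumℚ : List ℚ → ℚ
sumℚ []       = 0ℚ
sumℚ (x ∷ xs) = x + sumℚ xs

-- Pr over B ~ Bernoulli(p)^L of the event E(B)
prob : (L : ℕ) → ℚ → (Vec Bool L → Bool) → ℚ
prob L p E = sumℚ (map (weight p) (filterᵇ E (subsets L)))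

-- Pr( N(K_r, G_{u,m,n}) > t )
probKrExceeds : (u : ℚ) (m n r : ℕ) (t : ℚ) → ℚ
probKrExceeds u m n r t =
  prob (length (mSubsets n m)) (u * invℕ (n C m))
       (λ B → not (ℕtoℚ (numKr r (unionOfCliques (cliqueSets n m) B)) ≤ᵇ t))

{-# OPTIONS --safe #-}
-- Write u = v/w and L = C(n,m). Weighting a selection B by v^|B| (wL − v)^(L − |B|) gives (wL)^L times the
-- Bernoulli(u/L) product measure, so the whole argument runs in ℕ. For an r-set S let Y_S count the selected
-- m-sets containing S, let M count the selected m-sets and X the r-sets with Y_S > 0. Such r-sets span
-- cliques, so X ≤ N(K_r); also X ≤ C(m,r)·M and Σ_S Y_S = C(m,r)·M. Each Y_S is binomial with mean at most 1
-- (u·C(m,r) ≤ C(n,r) follows from u·m^r ≤ n^r), so E Σ_S Y_S² ≤ 2·C(m,r)·u, and 3y ≤ 2[y > 0] + y² yields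
-- E X ≥ C(m,r)·u/2. Off the event N(K_r) > δ·u·m^r we have X ≤ C(m,r)·u/128, because m^r ≤ 2^r·r!·C(m,r);
-- on it X ≤ C(m,r)·M, and AM–GM together with E M² ≤ 2u² bounds E[M; event]. Hence the event has
-- probability at least 1/9 > δ = 1/(1 + 128·2^r·r!).
module Submission where

open import Defs
open import Data.Bool using (Bool; true; false; _∧_; _∨_; not; T)
open import Data.Bool.Properties using (T-≡; ∨-zeroʳ; ∧-zeroʳ; ∧-identityʳ)
open import Data.Fin using (Fin)
open import Data.Fin.Properties using () renaming (_≟_ to _≟ᶠ_)
import Data.Integer as ℤ
import Data.Integer.Properties as ℤ
open import Data.List using (List; []; _∷_; _++_; map; length)
open import Data.List.Relation.Unary.All as All using (All; []; _∷_)
open import Data.Nat using (ℕ; zero; suc; _+_; _*_; _∸_; _^_; _≤_; _<_; _≤ᵇ_; _<ᵇ_; _≡ᵇ_; z≤n; s≤s; z<s;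
  NonZero; >-nonZero; >-nonZero⁻¹; _!)
open import Data.Nat.Properties
open import Algebra.Properties.CommutativeSemigroup +-commutativeSemigroup
  using () renaming (interchange to +-interchange)
open import Algebra.Properties.CommutativeSemigroup *-commutativeSemigroup
  using () renaming (interchange to *-interchange; x∙yz≈y∙xz to x*[y*z]≡y*[x*z]; x∙yz≈xz∙y to x*[y*z]≡x*z*y;
                     xy∙z≈y∙xz to x*y*z≡y*[x*z]; xy∙z≈yz∙x to x*y*z≡y*z*x)
open import Data.Nat.Combinatorics using (_C_; nCk+nC[k+1]≡[n+1]C[k+1]; k>n⇒nCk≡0; nCk≡nPk/k!)
open import Data.Nat.Combinatorics.Base using (_P_; _P′_)
open import Data.Nat.Combinatorics.Specification using (k!∣nP′k)
open import Data.Nat.DivMod using (_/_; m/n*n≡m)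
open import Data.Nat.Tactic.RingSolver using (solve-∀)
open import Data.Product using (Σ; ∃₂; _×_; _,_)
open import Data.Rational as ℚ using (ℚ; mkℚ; 0ℚ; 1ℚ; NonNegative)
  renaming (_<_ to _<ℚ_; _≤_ to _≤ℚ_; _*_ to _*ℚ_; _+_ to _+ℚ_; _-_ to _-ℚ_)
import Data.Rational.Properties as ℚ
open import Data.Rational.Solver using (module +-*-Solver)
open import Data.Rational.Unnormalised as ℚᵘ using (ℚᵘ; mkℚᵘ; *≡*; *≤*; *<*)
  renaming (_≃_ to _≃ᵘ_; _*_ to _*ᵘ_; _+_ to _+ᵘ_)
import Data.Rational.Unnormalised.Properties as ℚᵘ
open import Data.Unit using (tt)
open import Data.Vec as Vec using (Vec; []; _∷_; lookup)
open import Function using (_∘_; _$_)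
open import Function.Bundles using (Equivalence)
open import Relation.Nullary using (contradiction)
open import Relation.Nullary.Decidable using (⌊_⌋)
open import Relation.Binary.PropositionalEquality

𝟙 : Bool → ℕ
𝟙 false = 0
𝟙 true  = 1

∑ : {A : Set} → List A → (A → ℕ) → ℕ
∑ []       f = 0
∑ (x ∷ xs) f = f x + ∑ xs f

syntax ∑ xs (λ x → e) = ∑[ x ∈ xs ] e

module _ {A : Set} where

  ∑-++ : ∀ xs ys (f : A → ℕ) → ∑ (xs ++ ys) f ≡ ∑ xs f + ∑ ys f
  ∑-++ []       ys f = refl
  ∑-++ (x ∷ xs) ys f = trans (cong (f x +_) (∑-++ xs ys f)) (sym (+-assoc (f x) _ _))

  ∑-map : {B : Set} (g : B → A) (xs : List B) (f : A → ℕ) → ∑ (map g xs) f ≡ ∑ xs (f ∘ g)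
  ∑-map g []       f = refl
  ∑-map g (x ∷ xs) f = cong (f (g x) +_) (∑-map g xs f)

  ∑-congᴬ : ∀ {xs} {f g : A → ℕ} → All (λ x → f x ≡ g x) xs → ∑ xs f ≡ ∑ xs g
  ∑-congᴬ []       = refl
  ∑-congᴬ (e ∷ es) = cong₂ _+_ e (∑-congᴬ es)

  ∑-cong : ∀ xs {f g : A → ℕ} → (∀ x → f x ≡ g x) → ∑ xs f ≡ ∑ xs g
  ∑-cong xs e = ∑-congᴬ (All.universal e xs)

  ∑-monoᴬ : ∀ {xs} {f g : A → ℕ} → All (λ x → f x ≤ g x) xs → ∑ xs f ≤ ∑ xs g
  ∑-monoᴬ []       = z≤n
  ∑-monoᴬ (e ∷ es) = +-mono-≤ e (∑-monoᴬ es)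

  ∑-mono : ∀ xs {f g : A → ℕ} → (∀ x → f x ≤ g x) → ∑ xs f ≤ ∑ xs g
  ∑-mono xs e = ∑-monoᴬ (All.universal e xs)

  ∑-zero : ∀ xs {f : A → ℕ} → (∀ x → f x ≡ 0) → ∑ xs f ≡ 0
  ∑-zero []       e = refl
  ∑-zero (x ∷ xs) e = cong₂ _+_ (e x) (∑-zero xs e)

  ∑-const : (xs : List A) (c : ℕ) → ∑[ x ∈ xs ] c ≡ length xs * c
  ∑-const []       c = refl
  ∑-const (x ∷ xs) c = cong (c +_) (∑-const xs c)

  ∑-distrib-+ : ∀ xs (f g : A → ℕ) → ∑[ x ∈ xs ] (f x + g x) ≡ ∑ xs f + ∑ xs g
  ∑-distrib-+ []       f g = refl
  ∑-distrib-+ (x ∷ xs) f g =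
    trans (cong (f x + g x +_) (∑-distrib-+ xs f g)) (+-interchange (f x) (g x) _ _)

  ∑-distribˡ-* : ∀ xs c (f : A → ℕ) → ∑[ x ∈ xs ] (c * f x) ≡ c * ∑ xs f
  ∑-distribˡ-* []       c f = sym (*-zeroʳ c)
  ∑-distribˡ-* (x ∷ xs) c f = trans (cong (c * f x +_) (∑-distribˡ-* xs c f)) (sym (*-distribˡ-+ c (f x) _))

  ∑-filterᵇ : ∀ (p : A → Bool) xs (f : A → ℕ) → ∑ (filterᵇ p xs) f ≡ ∑[ x ∈ xs ] (𝟙 (p x) * f x)
  ∑-filterᵇ p []       f = refl
  ∑-filterᵇ p (x ∷ xs) f with p x
  ... | true  = cong₂ _+_ (sym (+-identityʳ (f x))) (∑-filterᵇ p xs f)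
  ... | false = ∑-filterᵇ p xs f

  length-filterᵇ : ∀ (p : A → Bool) xs → length (filterᵇ p xs) ≡ ∑[ x ∈ xs ] 𝟙 (p x)
  length-filterᵇ p []       = refl
  length-filterᵇ p (x ∷ xs) with p x
  ... | true  = cong suc (length-filterᵇ p xs)
  ... | false = length-filterᵇ p xs

∑-comm : {A B : Set} (xs : List A) (ys : List B) (h : A → B → ℕ) →
  ∑[ x ∈ xs ] ∑[ y ∈ ys ] h x y ≡ ∑[ y ∈ ys ] ∑[ x ∈ xs ] h x y
∑-comm []       ys h = sym (∑-zero ys (λ _ → refl))
∑-comm (x ∷ xs) ys h = trans (cong (∑ ys (h x) +_) (∑-comm xs ys h))
  (sym (∑-distrib-+ ys (h x) (λ y → ∑[ x ∈ xs ] h x y)))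

_⊆ᵇ_ : ∀ {n} → Vec Bool n → Vec Bool n → Bool
[]          ⊆ᵇ []      = true
(false ∷ S) ⊆ᵇ (_ ∷ X) = S ⊆ᵇ X
(true  ∷ S) ⊆ᵇ (x ∷ X) = x ∧ S ⊆ᵇ X

full : ∀ n → Vec Bool n
full zero    = []
full (suc n) = true ∷ full n

⊆ᵇ-full : ∀ {n} (S : Vec Bool n) → S ⊆ᵇ full n ≡ true
⊆ᵇ-full []          = refl
⊆ᵇ-full (false ∷ S) = ⊆ᵇ-full S
⊆ᵇ-full (true  ∷ S) = ⊆ᵇ-full S

card-full : ∀ n → card (full n) ≡ n
card-full zero    = refl
card-full (suc n) = cong suc (card-full n)

card≤ : ∀ {n} (S : Vec Bool n) → card S ≤ n
card≤ []          = z≤n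
card≤ (false ∷ S) = m≤n⇒m≤1+n (card≤ S)
card≤ (true  ∷ S) = s≤s (card≤ S)

⊆ᵇ⇒card≤ : ∀ {n} (S X : Vec Bool n) → S ⊆ᵇ X ≡ true → card S ≤ card X
⊆ᵇ⇒card≤ []          []          _  = z≤n
⊆ᵇ⇒card≤ (false ∷ S) (false ∷ X) S⊆X = ⊆ᵇ⇒card≤ S X S⊆X
⊆ᵇ⇒card≤ (false ∷ S) (true  ∷ X) S⊆X = m≤n⇒m≤1+n (⊆ᵇ⇒card≤ S X S⊆X)
⊆ᵇ⇒card≤ (true  ∷ S) (true  ∷ X) S⊆X = s≤s (⊆ᵇ⇒card≤ S X S⊆X)

mSubsets-card : ∀ n k → All (λ S → card S ≡ k) (mSubsets n k)
mSubsets-card n k = filtered (subsets n)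
  where
  filtered : ∀ Ss → All (λ S → card S ≡ k) (filterᵇ (λ S → card S ≡ᵇ k) Ss)
  filtered []       = []
  filtered (S ∷ Ss) with card S ≡ᵇ k in eq
  ... | true  = ≡ᵇ⇒≡ (card S) k (subst T (sym eq) tt) ∷ filtered Ss
  ... | false = filtered Ss

∑-subsets-suc : ∀ n (f : Vec Bool (suc n) → ℕ) →
  ∑ (subsets (suc n)) f ≡ ∑[ X ∈ subsets n ] f (false ∷ X) + ∑[ X ∈ subsets n ] f (true ∷ X)
∑-subsets-suc n f = trans (∑-++ (map (false ∷_) (subsets n)) _ f)
  (cong₂ _+_ (∑-map (false ∷_) (subsets n) f) (∑-map (true ∷_) (subsets n) f))

∑-mSubsets : ∀ n k (f : Vec Bool n → ℕ) → ∑ (mSubsets n k) f ≡ ∑[ X ∈ subsets n ] (𝟙 (card X ≡ᵇ k) * f X)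
∑-mSubsets n k = ∑-filterᵇ (λ X → card X ≡ᵇ k) (subsets n)

#subsets⊆ : ∀ {n} (X : Vec Bool n) k → ∑[ S ∈ mSubsets n k ] 𝟙 (S ⊆ᵇ X) ≡ card X C k
#subsets⊆ {n} X k = trans (∑-mSubsets n k _) (count X k)
  where
  count : ∀ {n} (X : Vec Bool n) k → ∑[ S ∈ subsets n ] (𝟙 (card S ≡ᵇ k) * 𝟙 (S ⊆ᵇ X)) ≡ card X C k
  count []          zero    = refl
  count []          (suc k) = sym (k>n⇒nCk≡0 {0} {suc k} (s≤s z≤n))
  count {suc n} (x ∷ X) k = trans (∑-subsets-suc n (λ S → 𝟙 (card S ≡ᵇ k) * 𝟙 (S ⊆ᵇ (x ∷ X)))) (first-coordinate x k)
    where
    first-coordinate : ∀ x k → ∑[ S ∈ subsets n ] (𝟙 (card S ≡ᵇ k) * 𝟙 (S ⊆ᵇ X))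
                      + ∑[ S ∈ subsets n ] (𝟙 (suc (card S) ≡ᵇ k) * 𝟙 (x ∧ S ⊆ᵇ X)) ≡ card (x ∷ X) C k
    first-coordinate false k = trans (cong₂ _+_ (count X k) (∑-zero (subsets n) (λ S → *-zeroʳ (𝟙 (suc (card S) ≡ᵇ k)))))
                              (+-identityʳ _)
    first-coordinate true zero    = cong₂ _+_ (count X zero) (∑-zero (subsets n) (λ _ → refl))
    first-coordinate true (suc k) = trans (cong₂ _+_ (count X (suc k)) (count X k))
      (trans (+-comm (card X C suc k) _) (nCk+nC[k+1]≡[n+1]C[k+1] (card X) k))

length-mSubsets : ∀ n k → length (mSubsets n k) ≡ n C k
length-mSubsets n k = begin
  length (mSubsets n k)                         ≡⟨ length-filterᵇ (λ X → card X ≡ᵇ k) (subsets n) ⟩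
  ∑[ S ∈ subsets n ] 𝟙 (card S ≡ᵇ k)           ≡⟨ ∑-cong (subsets n) (λ S → sym (*-identityʳ _)) ⟩
  ∑[ S ∈ subsets n ] (𝟙 (card S ≡ᵇ k) * 1)
    ≡⟨ ∑-cong (subsets n) (λ S → cong (λ b → 𝟙 (card S ≡ᵇ k) * 𝟙 b) (⊆ᵇ-full S)) ⟨
  ∑[ S ∈ subsets n ] (𝟙 (card S ≡ᵇ k) * 𝟙 (S ⊆ᵇ full n)) ≡⟨ ∑-mSubsets n k _ ⟨
  ∑[ S ∈ mSubsets n k ] 𝟙 (S ⊆ᵇ full n)       ≡⟨ #subsets⊆ (full n) k ⟩
  card (full n) C k                             ≡⟨ cong (_C k) (card-full n) ⟩
  n C k                                         ∎
  where open ≡-Reasoning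

#supersets⊇ : ∀ {n} (S : Vec Bool n) j → ∑[ X ∈ mSubsets n (card S + j) ] 𝟙 (S ⊆ᵇ X) ≡ (n ∸ card S) C j
#supersets⊇ {n} S j = trans (∑-mSubsets n (card S + j) _) (count S j)
  where
  no-small-superset : ∀ {n} (S X : Vec Bool n) k → k ≤ card S → 𝟙 (suc (card X) ≡ᵇ k) * 𝟙 (S ⊆ᵇ X) ≡ 0
  no-small-superset S X k k≤S with S ⊆ᵇ X in S⊆X | suc (card X) ≡ᵇ k in eq
  ... | false | b     = *-zeroʳ (𝟙 b)
  ... | true  | false = refl
  ... | true  | true  = contradiction (≤-trans k≤S (⊆ᵇ⇒card≤ S X S⊆X))
                          (<⇒≱ (≤-reflexive (≡ᵇ⇒≡ _ k (subst T (sym eq) tt))))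
  count : ∀ {n} (S : Vec Bool n) j →
    ∑[ X ∈ subsets n ] (𝟙 (card X ≡ᵇ card S + j) * 𝟙 (S ⊆ᵇ X)) ≡ (n ∸ card S) C j
  count []          zero    = refl
  count []          (suc j) = sym (k>n⇒nCk≡0 {0} {suc j} (s≤s z≤n))
  count {suc n} (true ∷ S) j = trans (∑-subsets-suc n (λ X → 𝟙 (card X ≡ᵇ suc (card S + j)) * 𝟙 ((true ∷ S) ⊆ᵇ X)))
    (trans (cong₂ _+_ (∑-zero (subsets n) (λ X → *-zeroʳ (𝟙 (card X ≡ᵇ suc (card S + j))))) refl) (count S j))
  count {suc n} (false ∷ S) j = trans (∑-subsets-suc n (λ X → 𝟙 (card X ≡ᵇ card S + j) * 𝟙 ((false ∷ S) ⊆ᵇ X)))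
    (trans (cong₂ _+_ (count S j) refl) (pascal j))
    where
    suc-n∸S : suc n ∸ card S ≡ suc (n ∸ card S)
    suc-n∸S = +-∸-assoc 1 (card≤ S)
    pascal : ∀ j → (n ∸ card S) C j + ∑[ X ∈ subsets n ] (𝟙 (suc (card X) ≡ᵇ card S + j) * 𝟙 (S ⊆ᵇ X))
                   ≡ (suc n ∸ card S) C j
    pascal zero    = cong₂ _+_ refl (∑-zero (subsets n) (λ X → no-small-superset S X _ (≤-reflexive (+-identityʳ _))))
    pascal (suc j) = begin
      (n ∸ card S) C suc j + ∑[ X ∈ subsets n ] (𝟙 (suc (card X) ≡ᵇ card S + suc j) * 𝟙 (S ⊆ᵇ X))
        ≡⟨ cong (λ k → (n ∸ card S) C suc j + ∑[ X ∈ subsets n ] (𝟙 (suc (card X) ≡ᵇ k) * 𝟙 (S ⊆ᵇ X)))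
                (+-suc (card S) j) ⟩
      (n ∸ card S) C suc j + ∑[ X ∈ subsets n ] (𝟙 (card X ≡ᵇ card S + j) * 𝟙 (S ⊆ᵇ X))
        ≡⟨ cong ((n ∸ card S) C suc j +_) (count S j) ⟩
      (n ∸ card S) C suc j + (n ∸ card S) C j  ≡⟨ +-comm ((n ∸ card S) C suc j) _ ⟩
      (n ∸ card S) C j + (n ∸ card S) C suc j  ≡⟨ nCk+nC[k+1]≡[n+1]C[k+1] (n ∸ card S) j ⟩
      suc (n ∸ card S) C suc j                 ≡⟨ cong (_C suc j) suc-n∸S ⟨
      (suc n ∸ card S) C suc j                 ∎
      where open ≡-Reasoning

nPk≡nP′k : ∀ {n k} → k ≤ n → (n P k) ≡ (n P′ k)
nPk≡nP′k {n} {k} k≤n with k ≤ᵇ n | Equivalence.to T-≡ (≤⇒≤ᵇ k≤n)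
... | true | _ = refl

nCk*k!≡nP′k : ∀ {n k} → k ≤ n → (n C k) * k ! ≡ (n P′ k)
nCk*k!≡nP′k {n} {k} k≤n = begin
  (n C k) * k !             ≡⟨ cong (_* k !) (nCk≡nPk/k! k≤n) ⟩
  ((n P k) / k !) * k !     ≡⟨ cong (λ x → (x / k !) * k !) (nPk≡nP′k k≤n) ⟩
  ((n P′ k) / k !) * k !    ≡⟨ m/n*n≡m (k!∣nP′k k≤n) ⟩
  (n P′ k)                  ∎
  where
  open ≡-Reasoning
  instance _ = k !≢0

nP′k>0 : ∀ {n k} → k ≤ n → 0 < (n P′ k)
nP′k>0 {k = zero}  _   = z<s
nP′k>0 {k = suc k} k<n = *-mono-< (m<n⇒0<n∸m k<n) (nP′k>0 (<⇒≤ k<n))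

nCk>0 : ∀ {n k} → k ≤ n → 0 < (n C k)
nCk>0 {n} {k} k≤n = n≢0⇒n>0 λ nCk≡0 →
  <⇒≢ (nP′k>0 k≤n) (trans (sym (cong (_* k !) nCk≡0)) (nCk*k!≡nP′k k≤n))

mP′k*n^k≤nP′k*m^k : ∀ {m n} k → m ≤ n → (m P′ k) * n ^ k ≤ (n P′ k) * m ^ k
mP′k*n^k≤nP′k*m^k zero    m≤n = ≤-refl
mP′k*n^k≤nP′k*m^k {m} {n} (suc k) m≤n = begin
  (m ∸ k) * (m P′ k) * (n * n ^ k)     ≡⟨ *-interchange (m ∸ k) (m P′ k) n (n ^ k) ⟩
  (m ∸ k) * n * ((m P′ k) * n ^ k)     ≤⟨ *-mono-≤ [m∸k]n≤[n∸k]m (mP′k*n^k≤nP′k*m^k k m≤n) ⟩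
  (n ∸ k) * m * ((n P′ k) * m ^ k)     ≡⟨ *-interchange (n ∸ k) (n P′ k) m (m ^ k) ⟨
  (n ∸ k) * (n P′ k) * (m * m ^ k)     ∎
  where
  open ≤-Reasoning
  [m∸k]n≤[n∸k]m : (m ∸ k) * n ≤ (n ∸ k) * m
  [m∸k]n≤[n∸k]m = begin
    (m ∸ k) * n   ≡⟨ *-distribʳ-∸ n m k ⟩
    m * n ∸ k * n ≤⟨ ∸-monoʳ-≤ (m * n) (*-monoʳ-≤ k m≤n) ⟩
    m * n ∸ k * m ≡⟨ cong (_∸ k * m) (*-comm m n) ⟩
    n * m ∸ k * m ≡⟨ *-distribʳ-∸ m n k ⟨
    (n ∸ k) * m   ∎

v*m^r≤w*n^r⇒v*mCr≤w*nCr : ∀ {v w m n r} .{{_ : NonZero n}} → r ≤ m → m ≤ n →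
  v * m ^ r ≤ w * n ^ r → v * (m C r) ≤ w * (n C r)
v*m^r≤w*n^r⇒v*mCr≤w*nCr {v} {w} {m} {n} {r} r≤m m≤n vm^r≤wn^r =
  *-cancelʳ-≤ _ _ (r ! * n ^ r) {{m*n≢0 _ _ {{r !≢0}} {{m^n≢0 n r}}}} $ begin
  v * (m C r) * (r ! * n ^ r)       ≡⟨ reassoc v (m C r) (r !) (n ^ r) ⟩
  v * ((m C r) * r ! * n ^ r)       ≡⟨ cong (λ x → v * (x * n ^ r)) (nCk*k!≡nP′k r≤m) ⟩
  v * ((m P′ r) * n ^ r)            ≤⟨ *-monoʳ-≤ v (mP′k*n^k≤nP′k*m^k r m≤n) ⟩
  v * ((n P′ r) * m ^ r)            ≡⟨ x*[y*z]≡y*[x*z] v (n P′ r) (m ^ r) ⟩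
  (n P′ r) * (v * m ^ r)            ≤⟨ *-monoʳ-≤ (n P′ r) vm^r≤wn^r ⟩
  (n P′ r) * (w * n ^ r)            ≡⟨ cong (_* (w * n ^ r)) (nCk*k!≡nP′k (≤-trans r≤m m≤n)) ⟨
  (n C r) * r ! * (w * n ^ r)       ≡⟨ reorder w (n C r) (r !) (n ^ r) ⟩
  w * (n C r) * (r ! * n ^ r)       ∎
  where
  open ≤-Reasoning
  reassoc : ∀ v c f z → v * c * (f * z) ≡ v * (c * f * z)
  reassoc = solve-∀
  reorder : ∀ w c f z → c * f * (w * z) ≡ w * c * (f * z)
  reorder = solve-∀

m^k≤2^k*mP′k : ∀ {m} k → 2 * k ≤ m → m ^ k ≤ 2 ^ k * (m P′ k)
m^k≤2^k*mP′k zero _ = ≤-refl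
m^k≤2^k*mP′k {m} (suc k) 2[1+k]≤m = begin
  m * m ^ k                         ≤⟨ *-mono-≤ m≤2[m∸k] (m^k≤2^k*mP′k k 2k≤m) ⟩
  2 * (m ∸ k) * (2 ^ k * (m P′ k))    ≡⟨ *-interchange 2 (m ∸ k) (2 ^ k) (m P′ k) ⟩
  2 * 2 ^ k * ((m ∸ k) * (m P′ k))    ∎
  where
  open ≤-Reasoning
  2k≤m : 2 * k ≤ m
  2k≤m = ≤-trans (*-monoʳ-≤ 2 (n≤1+n k)) 2[1+k]≤m
  k+k≤m : k + k ≤ m
  k+k≤m = subst (_≤ m) (cong (k +_) (+-identityʳ k)) 2k≤m
  m≤2[m∸k] : m ≤ 2 * (m ∸ k)
  m≤2[m∸k] = begin
    m                   ≡⟨ m∸n+n≡m (≤-trans (m≤m+n k k) k+k≤m) ⟨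
    (m ∸ k) + k         ≤⟨ +-monoʳ-≤ (m ∸ k) (m+n≤o⇒m≤o∸n k k+k≤m) ⟩
    (m ∸ k) + (m ∸ k)   ≡⟨ cong ((m ∸ k) +_) (+-identityʳ (m ∸ k)) ⟨
    2 * (m ∸ k)         ∎

m^r≤2^r*r!*mCr : ∀ {m} r → 2 * r ≤ m → m ^ r ≤ 2 ^ r * r ! * (m C r)
m^r≤2^r*r!*mCr {m} r 2r≤m = begin
  m ^ r                 ≤⟨ m^k≤2^k*mP′k r 2r≤m ⟩
  2 ^ r * (m P′ r)        ≡⟨ cong (2 ^ r *_) (nCk*k!≡nP′k r≤m) ⟨
  2 ^ r * ((m C r) * r !) ≡⟨ x*[y*z]≡x*z*y (2 ^ r) (m C r) (r !) ⟩
  2 ^ r * r ! * (m C r)   ∎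
  where
  open ≤-Reasoning
  r≤m : r ≤ m
  r≤m = ≤-trans (m≤n+m r r) (subst (_≤ m) (cong (r +_) (+-identityʳ r)) 2r≤m)

2*m*n≤m*m+n*n : ∀ m n → 2 * m * n ≤ m * m + n * n
2*m*n≤m*m+n*n zero    n       = z≤n
2*m*n≤m*m+n*n (suc m) zero    = ≤-trans (≤-reflexive (*-zeroʳ (2 * suc m))) z≤n
2*m*n≤m*m+n*n (suc m) (suc n) = begin
  2 * suc m * suc n                     ≡⟨ lhs m n ⟩
  2 * m * n + 2 * (m + n + 1)           ≤⟨ +-monoˡ-≤ _ (2*m*n≤m*m+n*n m n) ⟩
  m * m + n * n + 2 * (m + n + 1)       ≡⟨ rhs m n ⟩
  suc m * suc m + suc n * suc n         ∎
  where
  open ≤-Reasoning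
  lhs : ∀ m n → 2 * suc m * suc n ≡ 2 * m * n + 2 * (m + n + 1)
  lhs = solve-∀
  rhs : ∀ m n → m * m + n * n + 2 * (m + n + 1) ≡ suc m * suc m + suc n * suc n
  rhs = solve-∀

module Expectation {Ω : Set} (Ωs : List Ω) (W : Ω → ℕ) where

  𝔼 : (Ω → ℕ) → ℕ
  𝔼 f = ∑[ ω ∈ Ωs ] (W ω * f ω)

  mass : ℕ
  mass = 𝔼 (λ _ → 1)

  𝔼-cong : ∀ {f g} → (∀ ω → f ω ≡ g ω) → 𝔼 f ≡ 𝔼 g
  𝔼-cong f≗g = ∑-cong Ωs (λ ω → cong (W ω *_) (f≗g ω))

  𝔼-mono : ∀ {f g} → (∀ ω → f ω ≤ g ω) → 𝔼 f ≤ 𝔼 g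
  𝔼-mono f≤g = ∑-mono Ωs (λ ω → *-monoʳ-≤ (W ω) (f≤g ω))

  𝔼-distrib-+ : ∀ f g → 𝔼 (λ ω → f ω + g ω) ≡ 𝔼 f + 𝔼 g
  𝔼-distrib-+ f g = trans (∑-cong Ωs (λ ω → *-distribˡ-+ (W ω) (f ω) (g ω))) (∑-distrib-+ Ωs _ _)

  𝔼-distribˡ-* : ∀ c f → 𝔼 (λ ω → c * f ω) ≡ c * 𝔼 f
  𝔼-distribˡ-* c f = trans (∑-cong Ωs (λ ω → x*[y*z]≡y*[x*z] (W ω) c (f ω))) (∑-distribˡ-* Ωs c _)

  𝔼-const : ∀ c → 𝔼 (λ _ → c) ≡ c * mass
  𝔼-const c = trans (𝔼-cong (λ _ → sym (*-identityʳ c))) (𝔼-distribˡ-* c (λ _ → 1))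

  𝔼-∑ : {S : Set} (Ss : List S) (f : S → Ω → ℕ) → 𝔼 (λ ω → ∑[ s ∈ Ss ] f s ω) ≡ ∑[ s ∈ Ss ] 𝔼 (f s)
  𝔼-∑ Ss f = trans (∑-cong Ωs (λ ω → sym (∑-distribˡ-* Ss (W ω) (λ s → f s ω))))
                   (∑-comm Ωs Ss (λ ω s → W ω * f s ω))

  -- The second-moment argument pointwise, with AM–GM (2ab ≤ a² + b²) in place of Cauchy–Schwarz.
  -- In the application c = C(m,r), and μ, ξ, κ are w·M, w·X and w·Σ_S Y_S².
  pointwise-bound : ∀ {c v μ ξ κ} (t : Bool) →
    3 * c * μ ≤ 2 * ξ + κ → ξ ≤ c * μ → (t ≡ false → 128 * ξ ≤ v * c) →
    192 * v * c * μ ≤ v * v * c + 256 * (v * v * c) * 𝟙 t + 16 * c * (μ * μ) + 64 * v * κ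
  pointwise-bound {c} {v} {μ} {ξ} {κ} t 3cμ≤2ξ+κ ξ≤cμ ¬t⇒ξ-small = begin
    192 * v * c * μ           ≡⟨ split v c μ ⟩
    64 * v * (3 * c * μ)      ≤⟨ *-monoʳ-≤ (64 * v) 3cμ≤2ξ+κ ⟩
    64 * v * (2 * ξ + κ)      ≡⟨ expand v ξ κ ⟩
    128 * v * ξ + 64 * v * κ  ≤⟨ +-monoˡ-≤ (64 * v * κ) (by-event t ¬t⇒ξ-small) ⟩
    v * v * c + 256 * (v * v * c) * 𝟙 t + 16 * c * (μ * μ) + 64 * v * κ ∎
    where
    open ≤-Reasoning
    split : ∀ v c μ → 192 * v * c * μ ≡ 64 * v * (3 * c * μ)
    split = solve-∀
    expand : ∀ v ξ κ → 64 * v * (2 * ξ + κ) ≡ 128 * v * ξ + 64 * v * κ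
    expand = solve-∀
    by-event : ∀ t → (t ≡ false → 128 * ξ ≤ v * c) →
      128 * v * ξ ≤ v * v * c + 256 * (v * v * c) * 𝟙 t + 16 * c * (μ * μ)
    by-event false ξ-small = begin
      128 * v * ξ                          ≡⟨ x*y*z≡y*[x*z] 128 v ξ ⟩
      v * (128 * ξ)                        ≤⟨ *-monoʳ-≤ v (ξ-small refl) ⟩
      v * (v * c)                          ≡⟨ *-assoc v v c ⟨
      v * v * c                            ≤⟨ m≤m+n _ _ ⟩
      v * v * c + 256 * (v * v * c) * 0    ≤⟨ m≤m+n _ _ ⟩
      v * v * c + 256 * (v * v * c) * 0 + 16 * c * (μ * μ) ∎
    by-event true _ = begin
      128 * v * ξ                                     ≤⟨ *-monoʳ-≤ (128 * v) ξ≤cμ ⟩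
      128 * v * (c * μ)                               ≡⟨ as-product v c μ ⟩
      c * (2 * (16 * v) * (4 * μ))                    ≤⟨ *-monoʳ-≤ c (2*m*n≤m*m+n*n (16 * v) (4 * μ)) ⟩
      c * (16 * v * (16 * v) + 4 * μ * (4 * μ))       ≡⟨ as-sum v c μ ⟩
      256 * (v * v * c) * 1 + 16 * c * (μ * μ)        ≤⟨ m≤n+m _ (v * v * c) ⟩
      v * v * c + (256 * (v * v * c) * 1 + 16 * c * (μ * μ)) ≡⟨ +-assoc (v * v * c) _ _ ⟨
      v * v * c + 256 * (v * v * c) * 1 + 16 * c * (μ * μ)   ∎
      where
      as-product : ∀ v c μ → 128 * v * (c * μ) ≡ c * (2 * (16 * v) * (4 * μ))
      as-product = solve-∀
      as-sum : ∀ v c μ → c * (16 * v * (16 * v) + 4 * μ * (4 * μ)) ≡ 256 * (v * v * c) * 1 + 16 * c * (μ * μ)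
      as-sum = solve-∀

  module _ {c v : ℕ} {μ ξ κ : Ω → ℕ} (θ : Ω → Bool)
           (3cμ≤2ξ+κ : ∀ ω → 3 * c * μ ω ≤ 2 * ξ ω + κ ω) (ξ≤cμ : ∀ ω → ξ ω ≤ c * μ ω)
           (¬θ⇒ξ-small : ∀ ω → θ ω ≡ false → 128 * ξ ω ≤ v * c)
           (𝔼μ : 𝔼 μ ≡ v * mass) (𝔼μ² : 𝔼 (λ ω → μ ω * μ ω) ≤ 2 * (v * v) * mass)
           (𝔼κ : 𝔼 κ ≤ 2 * c * v * mass) where

    second-moment-bound : 192 * (v * v * c * mass) ≤ 161 * (v * v * c * mass) + 256 * (v * v * c * 𝔼 (𝟙 ∘ θ))
    second-moment-bound = begin
      192 * (X * mass)                 ≡⟨ x*[y*z]≡y*[x*z] 192 X mass ⟩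
      X * (192 * mass)                 ≡⟨ reassoc v c mass ⟩
      192 * v * c * (v * mass)         ≡⟨ cong (192 * v * c *_) 𝔼μ ⟨
      192 * v * c * 𝔼 μ                ≡⟨ 𝔼-distribˡ-* (192 * v * c) μ ⟨
      𝔼 (λ ω → 192 * v * c * μ ω)
        ≤⟨ 𝔼-mono (λ ω → pointwise-bound {c} {v} {μ ω} {ξ ω} {κ ω} (θ ω)
                           (3cμ≤2ξ+κ ω) (ξ≤cμ ω) (¬θ⇒ξ-small ω)) ⟩
      𝔼 (λ ω → X + 256 * X * 𝟙 (θ ω) + 16 * c * (μ ω * μ ω) + 64 * v * κ ω)
        ≡⟨ linearity ⟩
      X * mass + 256 * X * P + 16 * c * 𝔼 (λ ω → μ ω * μ ω) + 64 * v * 𝔼 κ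
        ≤⟨ +-mono-≤ (+-monoʳ-≤ (X * mass + 256 * X * P) (*-monoʳ-≤ (16 * c) 𝔼μ²)) (*-monoʳ-≤ (64 * v) 𝔼κ) ⟩
      X * mass + 256 * X * P + 16 * c * (2 * (v * v) * mass) + 64 * v * (2 * c * v * mass)
        ≡⟨ regroup v c mass P ⟩
      161 * (X * mass) + 256 * (X * P) ∎
      where
      open ≤-Reasoning
      P = 𝔼 (𝟙 ∘ θ)
      X = v * v * c
      reassoc : ∀ v c M → v * v * c * (192 * M) ≡ 192 * v * c * (v * M)
      reassoc = solve-∀
      regroup : ∀ v c M P → v * v * c * M + 256 * (v * v * c) * P + 16 * c * (2 * (v * v) * M) + 64 * v * (2 * c * v * M)
                          ≡ 161 * (v * v * c * M) + 256 * (v * v * c * P)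
      regroup = solve-∀
      linearity : 𝔼 (λ ω → X + 256 * X * 𝟙 (θ ω) + 16 * c * (μ ω * μ ω) + 64 * v * κ ω)
                ≡ X * mass + 256 * X * P + 16 * c * 𝔼 (λ ω → μ ω * μ ω) + 64 * v * 𝔼 κ
      linearity =
        trans (𝔼-distrib-+ (λ ω → X + 256 * X * 𝟙 (θ ω) + 16 * c * (μ ω * μ ω)) (λ ω → 64 * v * κ ω))
        (cong₂ _+_
          (trans (𝔼-distrib-+ (λ ω → X + 256 * X * 𝟙 (θ ω)) (λ ω → 16 * c * (μ ω * μ ω)))
            (cong₂ _+_
              (trans (𝔼-distrib-+ (λ _ → X) (λ ω → 256 * X * 𝟙 (θ ω)))
                (cong₂ _+_ (𝔼-const X) (𝔼-distribˡ-* (256 * X) (𝟙 ∘ θ))))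
              (𝔼-distribˡ-* (16 * c) (λ ω → μ ω * μ ω))))
          (𝔼-distribˡ-* (64 * v) κ))

    likely-by-second-moment : .{{NonZero c}} → .{{NonZero v}} → mass ≤ 9 * 𝔼 (𝟙 ∘ θ)
    likely-by-second-moment = *-cancelˡ-≤ 31 (*-cancelˡ-≤ X {{m*n≢0 (v * v) c {{m*n≢0 v v}}}} (begin
      X * (31 * mass)        ≡⟨ x*[y*z]≡y*[x*z] X 31 mass ⟩
      31 * (X * mass)        ≤⟨ +-cancelˡ-≤ (161 * (X * mass)) _ _
                                  (subst (_≤ 161 * (X * mass) + 256 * (X * P)) (192≡161+31 (X * mass)) second-moment-bound) ⟩
      256 * (X * P)          ≤⟨ *-monoˡ-≤ (X * P) (m≤m+n 256 23) ⟩
      279 * (X * P)          ≡⟨ 279[X*P]≡X*[31*[9*P]] X P ⟩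
      X * (31 * (9 * P))     ∎))
      where
      open ≤-Reasoning
      P = 𝔼 (𝟙 ∘ θ)
      X = v * v * c
      192≡161+31 : ∀ x → 192 * x ≡ 161 * x + 31 * x
      192≡161+31 = solve-∀
      279[X*P]≡X*[31*[9*P]] : ∀ x p → 279 * (x * p) ≡ x * (31 * (9 * p))
      279[X*P]≡X*[31*[9*P]] = solve-∀

∣_∩_∣ : ∀ {L} → Vec Bool L → Vec Bool L → ℕ
∣ []      ∩ []      ∣ = 0
∣ t ∷ T ∩ β ∷ B ∣ = 𝟙 (t ∧ β) + ∣ T ∩ B ∣

∣∩full∣≡card : ∀ {L} (T : Vec Bool L) → ∣ T ∩ full L ∣ ≡ card T
∣∩full∣≡card []          = refl
∣∩full∣≡card (false ∷ T) = ∣∩full∣≡card T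
∣∩full∣≡card (true  ∷ T) = cong suc (∣∩full∣≡card T)

-- 𝔼 is (d + a)^L times the expectation over i.i.d. Bernoulli(a / (d + a)) coordinates.
module Bernoulli (d a : ℕ) where

  weightⁿ : ∀ {L} → Vec Bool L → ℕ
  weightⁿ []          = 1
  weightⁿ (false ∷ B) = d * weightⁿ B
  weightⁿ (true  ∷ B) = a * weightⁿ B

  module _ {L : ℕ} where
    open Expectation (subsets L) (weightⁿ {L}) public

  𝔼-cons : ∀ {L} (f : Vec Bool (suc L) → ℕ) → 𝔼 f ≡ d * 𝔼 (λ B → f (false ∷ B)) + a * 𝔼 (λ B → f (true ∷ B))
  𝔼-cons {L} f = trans (∑-subsets-suc L (λ B → weightⁿ B * f B)) (cong₂ _+_
    (trans (∑-cong (subsets L) (λ B → *-assoc d (weightⁿ B) (f (false ∷ B)))) (∑-distribˡ-* (subsets L) d _))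
    (trans (∑-cong (subsets L) (λ B → *-assoc a (weightⁿ B) (f (true ∷ B)))) (∑-distribˡ-* (subsets L) a _)))

  mass≡ : ∀ L → mass {L} ≡ (d + a) ^ L
  mass≡ zero    = refl
  mass≡ (suc L) = trans (𝔼-cons {L} (λ _ → 1)) (trans (sym (*-distribʳ-+ (mass {L}) d a)) (cong ((d + a) *_) (mass≡ L)))

  first-moment : ∀ {L} (T : Vec Bool L) → 𝔼 ∣ T ∩_∣ * (d + a) ≡ card T * a * (d + a) ^ L
  first-moment {zero}  []          = refl
  first-moment {suc L} (false ∷ T) = begin
    𝔼 ∣ false ∷ T ∩_∣ * (d + a)        ≡⟨ cong (_* (d + a)) (𝔼-cons ∣ false ∷ T ∩_∣) ⟩
    (d * e + a * e) * (d + a)         ≡⟨ factor d a e ⟩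
    (d + a) * (e * (d + a))           ≡⟨ cong ((d + a) *_) (first-moment T) ⟩
    (d + a) * (card T * a * (d + a) ^ L) ≡⟨ x*[y*z]≡y*[x*z] (d + a) (card T * a) _ ⟩
    card T * a * (d + a) ^ suc L      ∎
    where
    open ≡-Reasoning
    e = 𝔼 ∣ T ∩_∣
    factor : ∀ d a e → (d * e + a * e) * (d + a) ≡ (d + a) * (e * (d + a))
    factor = solve-∀
  first-moment {suc L} (true ∷ T) = begin
    𝔼 ∣ true ∷ T ∩_∣ * (d + a)                      ≡⟨ cong (_* (d + a)) (𝔼-cons ∣ true ∷ T ∩_∣) ⟩
    (d * e + a * 𝔼 (λ B → 1 + ∣ T ∩ B ∣)) * (d + a)
      ≡⟨ cong (λ x → (d * e + a * x) * (d + a)) (𝔼-distrib-+ {L} (λ _ → 1) ∣ T ∩_∣) ⟩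
    (d * e + a * (mass {L} + e)) * (d + a)             ≡⟨ cong (λ x → (d * e + a * (x + e)) * (d + a)) (mass≡ L) ⟩
    (d * e + a * ((d + a) ^ L + e)) * (d + a)        ≡⟨ factor d a e ((d + a) ^ L) ⟩
    (d + a) * (e * (d + a)) + a * (d + a) ^ L * (d + a) ≡⟨ cong (λ x → (d + a) * x + a * (d + a) ^ L * (d + a)) (first-moment T) ⟩
    (d + a) * (card T * a * (d + a) ^ L) + a * (d + a) ^ L * (d + a) ≡⟨ collect (card T) d a ((d + a) ^ L) ⟩
    suc (card T) * a * (d + a) ^ suc L               ∎
    where
    open ≡-Reasoning
    e = 𝔼 ∣ T ∩_∣
    factor : ∀ d a e z → (d * e + a * (z + e)) * (d + a) ≡ (d + a) * (e * (d + a)) + a * z * (d + a)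
    factor = solve-∀
    collect : ∀ k d a z → (d + a) * (k * a * z) + a * z * (d + a) ≡ suc k * a * ((d + a) * z)
    collect = solve-∀

  second-moment : ∀ {L} (T : Vec Bool L) →
    𝔼 (λ B → ∣ T ∩ B ∣ * ∣ T ∩ B ∣) * ((d + a) * (d + a)) ≡ (card T * a * d + card T * card T * (a * a)) * (d + a) ^ L
  second-moment {zero}  []          = refl
  second-moment {suc L} (false ∷ T) = begin
    𝔼 (λ B → ∣ false ∷ T ∩ B ∣ * ∣ false ∷ T ∩ B ∣) * ((d + a) * (d + a))
      ≡⟨ cong (_* ((d + a) * (d + a))) (𝔼-cons (λ B → ∣ false ∷ T ∩ B ∣ * ∣ false ∷ T ∩ B ∣)) ⟩
    (d * s + a * s) * ((d + a) * (d + a))   ≡⟨ factor d a s ⟩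
    (d + a) * (s * ((d + a) * (d + a)))     ≡⟨ cong ((d + a) *_) (second-moment T) ⟩
    (d + a) * ((k * a * d + k * k * (a * a)) * (d + a) ^ L) ≡⟨ x*[y*z]≡y*[x*z] (d + a) (k * a * d + k * k * (a * a)) ((d + a) ^ L) ⟩
    (k * a * d + k * k * (a * a)) * (d + a) ^ suc L ∎
    where
    open ≡-Reasoning
    s = 𝔼 (λ B → ∣ T ∩ B ∣ * ∣ T ∩ B ∣)
    k = card T
    factor : ∀ d a s → (d * s + a * s) * ((d + a) * (d + a)) ≡ (d + a) * (s * ((d + a) * (d + a)))
    factor = solve-∀
  second-moment {suc L} (true ∷ T) = begin
    𝔼 (λ B → ∣ true ∷ T ∩ B ∣ * ∣ true ∷ T ∩ B ∣) * ((d + a) * (d + a))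
      ≡⟨ cong (_* ((d + a) * (d + a))) (𝔼-cons (λ B → ∣ true ∷ T ∩ B ∣ * ∣ true ∷ T ∩ B ∣)) ⟩
    (d * s + a * 𝔼 (λ B → (1 + ∣ T ∩ B ∣) * (1 + ∣ T ∩ B ∣))) * ((d + a) * (d + a))
      ≡⟨ cong (λ x → (d * s + a * x) * ((d + a) * (d + a))) shifted-square ⟩
    (d * s + a * ((d + a) ^ L + (2 * e + s))) * ((d + a) * (d + a))
      ≡⟨ factor d a s e ((d + a) ^ L) ⟩
    (d + a) * (s * ((d + a) * (d + a))) + a * (d + a) * (2 * (e * (d + a)) + (d + a) * (d + a) ^ L)
      ≡⟨ cong₂ (λ x y → (d + a) * x + a * (d + a) * (2 * y + (d + a) * (d + a) ^ L)) (second-moment T) (first-moment T) ⟩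
    (d + a) * ((k * a * d + k * k * (a * a)) * (d + a) ^ L) + a * (d + a) * (2 * (k * a * (d + a) ^ L) + (d + a) * (d + a) ^ L)
      ≡⟨ collect k d a ((d + a) ^ L) ⟩
    (suc k * a * d + suc k * suc k * (a * a)) * (d + a) ^ suc L ∎
    where
    open ≡-Reasoning
    s = 𝔼 (λ B → ∣ T ∩ B ∣ * ∣ T ∩ B ∣)
    e = 𝔼 ∣ T ∩_∣
    k = card T
    [1+y]²≡1+[2y+y²] : ∀ y → (1 + y) * (1 + y) ≡ 1 + (2 * y + y * y)
    [1+y]²≡1+[2y+y²] = solve-∀
    shifted-square : 𝔼 (λ B → (1 + ∣ T ∩ B ∣) * (1 + ∣ T ∩ B ∣)) ≡ (d + a) ^ L + (2 * e + s)
    shifted-square = begin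
      𝔼 (λ B → (1 + ∣ T ∩ B ∣) * (1 + ∣ T ∩ B ∣))
        ≡⟨ 𝔼-cong (λ B → [1+y]²≡1+[2y+y²] ∣ T ∩ B ∣) ⟩
      𝔼 (λ B → 1 + (2 * ∣ T ∩ B ∣ + ∣ T ∩ B ∣ * ∣ T ∩ B ∣))
        ≡⟨ 𝔼-distrib-+ {L} (λ _ → 1) _ ⟩
      mass {L} + 𝔼 (λ B → 2 * ∣ T ∩ B ∣ + ∣ T ∩ B ∣ * ∣ T ∩ B ∣)
        ≡⟨ cong₂ _+_ (mass≡ L) (𝔼-distrib-+ (λ B → 2 * ∣ T ∩ B ∣) _) ⟩
      (d + a) ^ L + (𝔼 (λ B → 2 * ∣ T ∩ B ∣) + s)
        ≡⟨ cong (λ x → (d + a) ^ L + (x + s)) (𝔼-distribˡ-* 2 ∣ T ∩_∣) ⟩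
      (d + a) ^ L + (2 * e + s)                                   ∎
    factor : ∀ d a s e z → (d * s + a * (z + (2 * e + s))) * ((d + a) * (d + a))
                         ≡ (d + a) * (s * ((d + a) * (d + a))) + a * (d + a) * (2 * (e * (d + a)) + (d + a) * z)
    factor = solve-∀
    collect : ∀ k d a z → (d + a) * ((k * a * d + k * k * (a * a)) * z) + a * (d + a) * (2 * (k * a * z) + (d + a) * z)
                        ≡ (suc k * a * d + suc k * suc k * (a * a)) * ((d + a) * z)
    collect = solve-∀

  second-moment-≤ : ∀ {L} (T : Vec Bool L) →
    𝔼 (λ B → ∣ T ∩ B ∣ * ∣ T ∩ B ∣) * ((d + a) * (d + a))
      ≤ (card T * a * (d + a) + card T * a * (card T * a)) * (d + a) ^ L
  second-moment-≤ {L} T = begin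
    𝔼 (λ B → ∣ T ∩ B ∣ * ∣ T ∩ B ∣) * ((d + a) * (d + a))    ≡⟨ second-moment T ⟩
    (card T * a * d + card T * card T * (a * a)) * (d + a) ^ L
      ≤⟨ *-monoˡ-≤ ((d + a) ^ L) (+-mono-≤ (*-monoʳ-≤ (card T * a) (m≤m+n d a)) (≤-reflexive (square (card T) a))) ⟩
    (card T * a * (d + a) + card T * a * (card T * a)) * (d + a) ^ L ∎
    where
    open ≤-Reasoning
    square : ∀ k a → k * k * (a * a) ≡ k * a * (k * a)
    square = solve-∀

containing : ∀ {n L} → Vec Bool n → Vec (Vec Bool n) L → Vec Bool L
containing S = Vec.map (S ⊆ᵇ_)

card-containing : ∀ {n} (S : Vec Bool n) xs → card (containing S (Vec.fromList xs)) ≡ ∑[ X ∈ xs ] 𝟙 (S ⊆ᵇ X)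
card-containing S []       = refl
card-containing S (X ∷ xs) with S ⊆ᵇ X
... | true  = cong suc (card-containing S xs)
... | false = card-containing S xs

card-containing-r-set : ∀ {n m r} (S : Vec Bool n) → card S ≡ r → r ≤ m →
  card (containing S (cliqueSets n m)) ≡ (n ∸ r) C (m ∸ r)
card-containing-r-set {n} {m} {r} S refl r≤m = begin
  card (containing S (cliqueSets n m))                   ≡⟨ card-containing S (mSubsets n m) ⟩
  ∑[ X ∈ mSubsets n m ] 𝟙 (S ⊆ᵇ X)
    ≡⟨ cong (λ k → ∑[ X ∈ mSubsets n k ] 𝟙 (S ⊆ᵇ X)) (m+[n∸m]≡n r≤m) ⟨
  ∑[ X ∈ mSubsets n (card S + (m ∸ card S)) ] 𝟙 (S ⊆ᵇ X) ≡⟨ #supersets⊇ S (m ∸ card S) ⟩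
  (n ∸ card S) C (m ∸ card S)                             ∎
  where open ≡-Reasoning

∑-∣containing∩∣ : ∀ {n} m r (xs : List (Vec Bool n)) → All (λ X → card X ≡ m) xs → (B : Vec Bool (length xs)) →
  ∑[ S ∈ mSubsets n r ] ∣ containing S (Vec.fromList xs) ∩ B ∣ ≡ (m C r) * ∣ full (length xs) ∩ B ∣
∑-∣containing∩∣ {n} m r []       []           []       = trans (∑-zero (mSubsets n r) (λ _ → refl)) (sym (*-zeroʳ (m C r)))
∑-∣containing∩∣ {n} m r (X ∷ xs) (refl ∷ cards) (β ∷ B) = begin
  ∑[ S ∈ Ss ] (𝟙 (S ⊆ᵇ X ∧ β) + ∣ containing S (Vec.fromList xs) ∩ B ∣)
    ≡⟨ ∑-distrib-+ Ss (λ S → 𝟙 (S ⊆ᵇ X ∧ β)) _ ⟩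
  ∑[ S ∈ Ss ] 𝟙 (S ⊆ᵇ X ∧ β) + ∑[ S ∈ Ss ] ∣ containing S (Vec.fromList xs) ∩ B ∣
    ≡⟨ cong₂ _+_ (head β) (∑-∣containing∩∣ m r xs cards B) ⟩
  (card X C r) * 𝟙 β + (card X C r) * ∣ full (length xs) ∩ B ∣
    ≡⟨ *-distribˡ-+ (card X C r) (𝟙 β) _ ⟨
  (card X C r) * (𝟙 β + ∣ full (length xs) ∩ B ∣) ∎
  where
  open ≡-Reasoning
  Ss = mSubsets n r
  head : ∀ β → ∑[ S ∈ Ss ] 𝟙 (S ⊆ᵇ X ∧ β) ≡ (card X C r) * 𝟙 β
  head false = trans (∑-zero Ss (λ S → cong 𝟙 (∧-zeroʳ (S ⊆ᵇ X)))) (sym (*-zeroʳ (card X C r)))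
  head true  = trans (∑-cong Ss (λ S → cong 𝟙 (∧-identityʳ (S ⊆ᵇ X))))
                     (trans (#subsets⊆ X r) (sym (*-identityʳ (card X C r))))

allᵇ-intro : ∀ {k} {f : Fin k → Bool} → (∀ i → f i ≡ true) → allᵇ f ≡ true
allᵇ-intro {zero}  _       = refl
allᵇ-intro {suc k} all-true rewrite all-true Fin.zero = allᵇ-intro (λ i → all-true (Fin.suc i))

⊆ᵇ-lookup : ∀ {n} (S X : Vec Bool n) i → S ⊆ᵇ X ≡ true → lookup S i ≡ true → lookup X i ≡ true
⊆ᵇ-lookup (true  ∷ S) (true ∷ X) Fin.zero    _   _   = refl
⊆ᵇ-lookup (false ∷ S) (_    ∷ X) (Fin.suc i) S⊆X S[i] = ⊆ᵇ-lookup S X i S⊆X S[i]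
⊆ᵇ-lookup (true  ∷ S) (true ∷ X) (Fin.suc i) S⊆X S[i] = ⊆ᵇ-lookup S X i S⊆X S[i]

selected-superset⇒edge : ∀ {n L} (Cs : Vec (Vec Bool n) L) (B : Vec Bool L) (S : Vec Bool n) i j →
  0 < ∣ containing S Cs ∩ B ∣ → lookup S i ≡ true → lookup S j ≡ true →
  anyᵇ (Vec.zipWith (λ b X → b ∧ lookup X i ∧ lookup X j) B Cs) ≡ true
selected-superset⇒edge []       []      S i j ()      _    _
selected-superset⇒edge (X ∷ Cs) (β ∷ B) S i j covered S[i] S[j] with S ⊆ᵇ X in S⊆X | β
... | true  | true  rewrite ⊆ᵇ-lookup S X i S⊆X S[i] | ⊆ᵇ-lookup S X j S⊆X S[j] = refl
... | true  | false = selected-superset⇒edge Cs B S i j covered S[i] S[j]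
... | false | false = selected-superset⇒edge Cs B S i j covered S[i] S[j]
... | false | true  = trans (cong (lookup X i ∧ lookup X j ∨_) (selected-superset⇒edge Cs B S i j covered S[i] S[j]))
                            (∨-zeroʳ _)

covered⇒clique : ∀ {n L} (Cs : Vec (Vec Bool n) L) (B : Vec Bool L) (S : Vec Bool n) →
  0 < ∣ containing S Cs ∩ B ∣ → isClique (unionOfCliques Cs B) S ≡ true
covered⇒clique Cs B S covered = allᵇ-intro λ i → allᵇ-intro λ j →
  edge-or-not-pair (lookup S i) (lookup S j) ⌊ i ≟ᶠ j ⌋ _ (selected-superset⇒edge Cs B S i j covered)
  where
  edge-or-not-pair : ∀ sᵢ sⱼ i≡j e → (sᵢ ≡ true → sⱼ ≡ true → e ≡ true) →
    not (sᵢ ∧ sⱼ ∧ not i≡j) ∨ (not i≡j ∧ e) ≡ true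
  edge-or-not-pair false _     _     _ _    = refl
  edge-or-not-pair true  false _     _ _    = refl
  edge-or-not-pair true  true  true  _ _    = refl
  edge-or-not-pair true  true  false _ edge = edge refl refl

3y≤2[0<y]+y² : ∀ y → 3 * y ≤ 2 * 𝟙 (0 <ᵇ y) + y * y
3y≤2[0<y]+y² zero                = z≤n
3y≤2[0<y]+y² (suc zero)          = ≤-refl
3y≤2[0<y]+y² (suc (suc y))       = ≤-trans (m≤m+n _ (y * y + y)) (≤-reflexive (expand y))
  where
  expand : ∀ y → 3 * (2 + y) + (y * y + y) ≡ 2 * 1 + (2 + y) * (2 + y)
  expand = solve-∀

module RandomCliqueGraph (n m r : ℕ) where

  L : ℕ
  L = length (mSubsets n m)

  G : Vec Bool L → Graph n
  G = unionOfCliques (cliqueSets n m)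

  coverage : Vec Bool n → Vec Bool L → ℕ
  coverage S B = ∣ containing S (cliqueSets n m) ∩ B ∣

  #selected : Vec Bool L → ℕ
  #selected B = ∣ full L ∩ B ∣

  #covered : Vec Bool L → ℕ
  #covered B = ∑[ S ∈ mSubsets n r ] 𝟙 (0 <ᵇ coverage S B)

  ∑coverage² : Vec Bool L → ℕ
  ∑coverage² B = ∑[ S ∈ mSubsets n r ] (coverage S B * coverage S B)

  #covered≤#Kr : ∀ B → #covered B ≤ numKr r (G B)
  #covered≤#Kr B = ≤-trans (∑-mono (mSubsets n r) covered≤clique)
                           (≤-reflexive (sym (length-filterᵇ (isClique (G B)) (mSubsets n r))))
    where
    covered≤clique : ∀ S → 𝟙 (0 <ᵇ coverage S B) ≤ 𝟙 (isClique (G B) S)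
    covered≤clique S with coverage S B in eq
    ... | zero  = z≤n
    ... | suc _ rewrite covered⇒clique (cliqueSets n m) B S (subst (0 <_) (sym eq) z<s) = ≤-refl

  ∑coverage≡ : ∀ B → ∑[ S ∈ mSubsets n r ] coverage S B ≡ (m C r) * #selected B
  ∑coverage≡ = ∑-∣containing∩∣ m r (mSubsets n m) (mSubsets-card n m)

  #covered≤mCr*#selected : ∀ B → #covered B ≤ (m C r) * #selected B
  #covered≤mCr*#selected B = ≤-trans (∑-mono (mSubsets n r) (λ S → 0<ᵇ≤ (coverage S B))) (≤-reflexive (∑coverage≡ B))
    where
    0<ᵇ≤ : ∀ y → 𝟙 (0 <ᵇ y) ≤ y
    0<ᵇ≤ zero    = z≤n
    0<ᵇ≤ (suc y) = s≤s z≤n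

  3*mCr*#selected≤2*#covered+∑coverage² : ∀ B → 3 * (m C r) * #selected B ≤ 2 * #covered B + ∑coverage² B
  3*mCr*#selected≤2*#covered+∑coverage² B = begin
    3 * (m C r) * #selected B                        ≡⟨ *-assoc 3 (m C r) _ ⟩
    3 * ((m C r) * #selected B)                      ≡⟨ cong (3 *_) (∑coverage≡ B) ⟨
    3 * ∑[ S ∈ Ss ] coverage S B                     ≡⟨ ∑-distribˡ-* Ss 3 _ ⟨
    ∑[ S ∈ Ss ] (3 * coverage S B)                   ≤⟨ ∑-mono Ss (λ S → 3y≤2[0<y]+y² (coverage S B)) ⟩
    ∑[ S ∈ Ss ] (2 * 𝟙 (0 <ᵇ coverage S B) + coverage S B * coverage S B)
                                                     ≡⟨ ∑-distrib-+ Ss _ _ ⟩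
    ∑[ S ∈ Ss ] (2 * 𝟙 (0 <ᵇ coverage S B)) + ∑coverage² B ≡⟨ cong (_+ ∑coverage² B) (∑-distribˡ-* Ss 2 _) ⟩
    2 * #covered B + ∑coverage² B                       ∎
    where
    open ≤-Reasoning
    Ss = mSubsets n r

  double-counting : r ≤ m → (n C r) * ((n ∸ r) C (m ∸ r)) ≡ L * (m C r)
  double-counting r≤m = begin
    (n C r) * K                                       ≡⟨ cong (_* K) (length-mSubsets n r) ⟨
    length Ss * K                                     ≡⟨ ∑-const Ss K ⟨
    ∑[ S ∈ Ss ] K
      ≡⟨ ∑-congᴬ (All.map (λ {S} card≡r → sym (card-containing-r-set S card≡r r≤m)) (mSubsets-card n r)) ⟩
    ∑[ S ∈ Ss ] card (containing S (cliqueSets n m))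
      ≡⟨ ∑-cong Ss (λ S → ∣∩full∣≡card (containing S (cliqueSets n m))) ⟨
    ∑[ S ∈ Ss ] coverage S (full L)                   ≡⟨ ∑coverage≡ (full L) ⟩
    (m C r) * #selected (full L)                      ≡⟨ cong ((m C r) *_) (trans (∣∩full∣≡card (full L)) (card-full L)) ⟩
    (m C r) * L                                       ≡⟨ *-comm (m C r) L ⟩
    L * (m C r)                                       ∎
    where
    open ≡-Reasoning
    Ss = mSubsets n r
    K = (n ∸ r) C (m ∸ r)

private
  ι : ℕ → ℚᵘ
  ι k = mkℚᵘ (ℤ.+ k) 0

  -- ℕtoℚ k and invℕ (suc k) compute to fromℚᵘ (ι k) and fromℚᵘ (mkℚᵘ (+ 1) k).
  toℚᵘ-ℕtoℚ : ∀ k → ℚ.toℚᵘ (ℕtoℚ k) ≃ᵘ ι k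
  toℚᵘ-ℕtoℚ k = ℚ.toℚᵘ-fromℚᵘ (ι k)

  ι-homo-+ : ∀ a b → ι a +ᵘ ι b ≃ᵘ ι (a + b)
  ι-homo-+ a b = *≡* (cong (ℤ._* ℤ.+ 1)
    (trans (cong₂ ℤ._+_ (ℤ.*-identityʳ (ℤ.+ a)) (ℤ.*-identityʳ (ℤ.+ b))) (sym (ℤ.pos-+ a b))))

  ι-homo-* : ∀ a b → ι a *ᵘ ι b ≃ᵘ ι (a * b)
  ι-homo-* a b = *≡* (cong (ℤ._* ℤ.+ 1) (sym (ℤ.pos-* a b)))

ℕtoℚ-+ : ∀ a b → ℕtoℚ (a + b) ≡ ℕtoℚ a +ℚ ℕtoℚ b
ℕtoℚ-+ a b = ℚ.toℚᵘ-injective (begin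
  ℚ.toℚᵘ (ℕtoℚ (a + b))                   ≈⟨ toℚᵘ-ℕtoℚ (a + b) ⟩
  ι (a + b)                                ≈⟨ ι-homo-+ a b ⟨
  ι a +ᵘ ι b                               ≈⟨ ℚᵘ.+-cong (toℚᵘ-ℕtoℚ a) (toℚᵘ-ℕtoℚ b) ⟨
  ℚ.toℚᵘ (ℕtoℚ a) +ᵘ ℚ.toℚᵘ (ℕtoℚ b)      ≈⟨ ℚ.toℚᵘ-homo-+ (ℕtoℚ a) (ℕtoℚ b) ⟨
  ℚ.toℚᵘ (ℕtoℚ a +ℚ ℕtoℚ b)               ∎)
  where open ℚᵘ.≃-Reasoning

ℕtoℚ-* : ∀ a b → ℕtoℚ (a * b) ≡ ℕtoℚ a *ℚ ℕtoℚ b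
ℕtoℚ-* a b = ℚ.toℚᵘ-injective (begin
  ℚ.toℚᵘ (ℕtoℚ (a * b))                   ≈⟨ toℚᵘ-ℕtoℚ (a * b) ⟩
  ι (a * b)                                ≈⟨ ι-homo-* a b ⟨
  ι a *ᵘ ι b                               ≈⟨ ℚᵘ.*-cong (toℚᵘ-ℕtoℚ a) (toℚᵘ-ℕtoℚ b) ⟨
  ℚ.toℚᵘ (ℕtoℚ a) *ᵘ ℚ.toℚᵘ (ℕtoℚ b)      ≈⟨ ℚ.toℚᵘ-homo-* (ℕtoℚ a) (ℕtoℚ b) ⟨
  ℚ.toℚᵘ (ℕtoℚ a *ℚ ℕtoℚ b)               ∎)
  where open ℚᵘ.≃-Reasoning

ℕtoℚ-mono-< : ∀ {a b} → a < b → ℕtoℚ a <ℚ ℕtoℚ b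
ℕtoℚ-mono-< {a} {b} a<b = ℚ.toℚᵘ-cancel-<
  (ℚᵘ.<-respˡ-≃ (ℚᵘ.≃-sym (toℚᵘ-ℕtoℚ a)) (ℚᵘ.<-respʳ-≃ (ℚᵘ.≃-sym (toℚᵘ-ℕtoℚ b))
    (*<* (subst₂ ℤ._<_ (sym (ℤ.*-identityʳ (ℤ.+ a))) (sym (ℤ.*-identityʳ (ℤ.+ b))) (ℤ.+<+ a<b)))))

ℕtoℚ-cancel-≤ : ∀ {a b} → ℕtoℚ a ≤ℚ ℕtoℚ b → a ≤ b
ℕtoℚ-cancel-≤ {a} {b} a≤b
  with ℚᵘ.≤-respˡ-≃ (toℚᵘ-ℕtoℚ a) (ℚᵘ.≤-respʳ-≃ (toℚᵘ-ℕtoℚ b) (ℚ.toℚᵘ-mono-≤ a≤b))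
... | *≤* le = ℤ.drop‿+≤+ (subst₂ ℤ._≤_ (ℤ.*-identityʳ (ℤ.+ a)) (ℤ.*-identityʳ (ℤ.+ b)) le)

ℕtoℚ-nonNeg : ∀ k → NonNegative (ℕtoℚ k)
ℕtoℚ-nonNeg k = ℚ.normalize-nonNeg k 1

invℕ-pos : ∀ k → 0ℚ <ℚ invℕ (suc k)
invℕ-pos k = ℚ.positive⁻¹ (invℕ (suc k)) {{ℚ.normalize-pos 1 (suc k)}}

invℕ-inverse : ∀ k → .{{NonZero k}} → invℕ k *ℚ ℕtoℚ k ≡ 1ℚ
invℕ-inverse (suc k) = ℚ.toℚᵘ-injective (begin
  ℚ.toℚᵘ (invℕ (suc k) *ℚ ℕtoℚ (suc k))             ≈⟨ ℚ.toℚᵘ-homo-* (invℕ (suc k)) (ℕtoℚ (suc k)) ⟩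
  ℚ.toℚᵘ (invℕ (suc k)) *ᵘ ℚ.toℚᵘ (ℕtoℚ (suc k))
    ≈⟨ ℚᵘ.*-cong (ℚ.toℚᵘ-fromℚᵘ (mkℚᵘ (ℤ.+ 1) k)) (toℚᵘ-ℕtoℚ (suc k)) ⟩
  mkℚᵘ (ℤ.+ 1) k *ᵘ ι (suc k)
    ≈⟨ *≡* (trans (ℤ.*-identityʳ _) (trans (ℤ.*-identityˡ (ℤ.+ suc k))
             (cong ℤ.+_ (sym (trans (*-identityˡ (suc k * 1)) (*-identityʳ (suc k))))))) ⟩
  ℚᵘ.1ℚᵘ                                             ∎)
  where open ℚᵘ.≃-Reasoning

ratio-of-naturals : ∀ {u} → 1ℚ ≤ℚ u → ∃₂ λ v w → NonZero w × w ≤ v × u *ℚ ℕtoℚ w ≡ ℕtoℚ v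
ratio-of-naturals {mkℚ ℤ.-[1+ _ ] _ _} (ℚ.*≤* ())
ratio-of-naturals {u@(mkℚ (ℤ.+ v) w-1 _)} 1≤u = v , suc w-1 , _ , w≤v , uw≡v
  where
  w≤v : suc w-1 ≤ v
  w≤v with ℚ.toℚᵘ-mono-≤ 1≤u
  ... | *≤* le = ℤ.drop‿+≤+ (subst₂ ℤ._≤_ (ℤ.*-identityˡ (ℤ.+ suc w-1)) (ℤ.*-identityʳ (ℤ.+ v)) le)
  uw≡v : u *ℚ ℕtoℚ (suc w-1) ≡ ℕtoℚ v
  uw≡v = ℚ.toℚᵘ-injective (begin
    ℚ.toℚᵘ (u *ℚ ℕtoℚ (suc w-1))               ≈⟨ ℚ.toℚᵘ-homo-* u (ℕtoℚ (suc w-1)) ⟩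
    mkℚᵘ (ℤ.+ v) w-1 *ᵘ ℚ.toℚᵘ (ℕtoℚ (suc w-1))
      ≈⟨ ℚᵘ.*-cong (ℚᵘ.≃-refl {mkℚᵘ (ℤ.+ v) w-1}) (toℚᵘ-ℕtoℚ (suc w-1)) ⟩
    mkℚᵘ (ℤ.+ v) w-1 *ᵘ ι (suc w-1)
      ≈⟨ *≡* (trans (ℤ.*-identityʳ _) (cong (λ d → ℤ.+ v ℤ.* ℤ.+ d) (sym (*-identityʳ (suc w-1))))) ⟩
    ι v                                          ≈⟨ toℚᵘ-ℕtoℚ v ⟨
    ℚ.toℚᵘ (ℕtoℚ v)                              ∎)
    where open ℚᵘ.≃-Reasoning

module _ {A : Set} (f : A → ℚ) (g : A → ℕ) (z : ℚ) (scaled : ∀ x → f x *ℚ z ≡ ℕtoℚ (g x)) where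

  sumℚ-filterᵇ-scaled : ∀ (E : A → Bool) xs →
    sumℚ (map f (filterᵇ E xs)) *ℚ z ≡ ℕtoℚ (∑[ x ∈ xs ] (g x * 𝟙 (E x)))
  sumℚ-filterᵇ-scaled E []       = ℚ.*-zeroˡ z
  sumℚ-filterᵇ-scaled E (x ∷ xs) with E x
  ... | true  = begin
    (f x +ℚ sumℚ (map f (filterᵇ E xs))) *ℚ z               ≡⟨ ℚ.*-distribʳ-+ z (f x) (sumℚ (map f (filterᵇ E xs))) ⟩
    f x *ℚ z +ℚ sumℚ (map f (filterᵇ E xs)) *ℚ z            ≡⟨ cong₂ _+ℚ_ (scaled x) (sumℚ-filterᵇ-scaled E xs) ⟩
    ℕtoℚ (g x) +ℚ ℕtoℚ (∑[ x ∈ xs ] (g x * 𝟙 (E x)))       ≡⟨ ℕtoℚ-+ (g x) (∑[ x ∈ xs ] (g x * 𝟙 (E x))) ⟨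
    ℕtoℚ (g x + ∑[ x ∈ xs ] (g x * 𝟙 (E x)))
      ≡⟨ cong (λ y → ℕtoℚ (y + ∑[ x ∈ xs ] (g x * 𝟙 (E x)))) (*-identityʳ (g x)) ⟨
    ℕtoℚ (g x * 1 + ∑[ x ∈ xs ] (g x * 𝟙 (E x)))            ∎
    where open ≡-Reasoning
  ... | false = trans (sumℚ-filterᵇ-scaled E xs) (cong (λ y → ℕtoℚ (y + ∑[ x ∈ xs ] (g x * 𝟙 (E x))))
                                                              (sym (*-zeroʳ (g x))))

*ℚ-interchange : ∀ a b c d → a *ℚ b *ℚ (c *ℚ d) ≡ a *ℚ c *ℚ (b *ℚ d)
*ℚ-interchange = solve 4 (λ a b c d → a :* b :* (c :* d) := a :* c :* (b :* d)) refl
  where open +-*-Solver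

scaled-* : ∀ q b c x z y → q *ℚ ℕtoℚ b ≡ ℕtoℚ c → x *ℚ ℕtoℚ z ≡ ℕtoℚ y →
  (q *ℚ x) *ℚ ℕtoℚ (b * z) ≡ ℕtoℚ (c * y)
scaled-* q b c x z y qb≡c xz≡y = begin
  (q *ℚ x) *ℚ ℕtoℚ (b * z)             ≡⟨ cong ((q *ℚ x) *ℚ_) (ℕtoℚ-* b z) ⟩
  (q *ℚ x) *ℚ (ℕtoℚ b *ℚ ℕtoℚ z)       ≡⟨ *ℚ-interchange q x (ℕtoℚ b) (ℕtoℚ z) ⟩
  (q *ℚ ℕtoℚ b) *ℚ (x *ℚ ℕtoℚ z)       ≡⟨ cong₂ _*ℚ_ qb≡c xz≡y ⟩
  ℕtoℚ c *ℚ ℕtoℚ y                     ≡⟨ ℕtoℚ-* c y ⟨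
  ℕtoℚ (c * y)                         ∎
  where
  open ≡-Reasoning

module BernoulliWeights (d a : ℕ) (p : ℚ) (p[d+a]≡a : p *ℚ ℕtoℚ (d + a) ≡ ℕtoℚ a) where

  open Bernoulli d a

  [1-p][d+a]≡d : (1ℚ -ℚ p) *ℚ ℕtoℚ (d + a) ≡ ℕtoℚ d
  [1-p][d+a]≡d = begin
    (1ℚ -ℚ p) *ℚ ℕtoℚ (d + a)            ≡⟨ distrib p (ℕtoℚ (d + a)) ⟩
    ℕtoℚ (d + a) -ℚ p *ℚ ℕtoℚ (d + a)    ≡⟨ cong (ℕtoℚ (d + a) -ℚ_) p[d+a]≡a ⟩
    ℕtoℚ (d + a) -ℚ ℕtoℚ a               ≡⟨ cong (_-ℚ ℕtoℚ a) (ℕtoℚ-+ d a) ⟩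
    ℕtoℚ d +ℚ ℕtoℚ a -ℚ ℕtoℚ a           ≡⟨ cancel (ℕtoℚ d) (ℕtoℚ a) ⟩
    ℕtoℚ d                               ∎
    where
    open ≡-Reasoning
    open +-*-Solver
    distrib : ∀ p b → (1ℚ -ℚ p) *ℚ b ≡ b -ℚ p *ℚ b
    distrib = solve 2 (λ p b → (con 1ℚ :- p) :* b := b :- p :* b) refl
    cancel : ∀ x y → x +ℚ y -ℚ y ≡ x
    cancel = solve 2 (λ x y → x :+ y :- y := x) refl

  weight-scaled : ∀ {L} (B : Vec Bool L) → weight p B *ℚ ℕtoℚ ((d + a) ^ L) ≡ ℕtoℚ (weightⁿ B)
  weight-scaled         []          = ℚ.*-identityˡ 1ℚ
  weight-scaled {suc L} (true ∷ B)  =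
    scaled-* p (d + a) a (weight p B) ((d + a) ^ L) (weightⁿ B) p[d+a]≡a (weight-scaled B)
  weight-scaled {suc L} (false ∷ B) =
    scaled-* (1ℚ -ℚ p) (d + a) d (weight p B) ((d + a) ^ L) (weightⁿ B) [1-p][d+a]≡d (weight-scaled B)

  prob-scaled : ∀ L (E : Vec Bool L → Bool) → prob L p E *ℚ ℕtoℚ ((d + a) ^ L) ≡ ℕtoℚ (𝔼 (𝟙 ∘ E))
  prob-scaled L E = sumℚ-filterᵇ-scaled (weight p) weightⁿ (ℕtoℚ ((d + a) ^ L)) weight-scaled E (subsets L)

clear-denominator-≤ : ∀ {u v w A B} → u *ℚ ℕtoℚ w ≡ ℕtoℚ v → u *ℚ ℕtoℚ A ≤ℚ ℕtoℚ B → v * A ≤ w * B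
clear-denominator-≤ {u} {v} {w} {A} {B} uw≡v uA≤B = subst (v * A ≤_) (*-comm B w) $ ℕtoℚ-cancel-≤ $ begin
  ℕtoℚ (v * A)                   ≡⟨ ℕtoℚ-* v A ⟩
  ℕtoℚ v *ℚ ℕtoℚ A               ≡⟨ cong (_*ℚ ℕtoℚ A) uw≡v ⟨
  u *ℚ ℕtoℚ w *ℚ ℕtoℚ A          ≡⟨ swap u (ℕtoℚ w) (ℕtoℚ A) ⟩
  u *ℚ ℕtoℚ A *ℚ ℕtoℚ w          ≤⟨ ℚ.*-monoʳ-≤-nonNeg (ℕtoℚ w) {{ℕtoℚ-nonNeg w}} uA≤B ⟩
  ℕtoℚ B *ℚ ℕtoℚ w               ≡⟨ ℕtoℚ-* B w ⟨
  ℕtoℚ (B * w)                   ∎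
  where
  open ℚ.≤-Reasoning
  open +-*-Solver
  swap : ∀ x y z → x *ℚ y *ℚ z ≡ x *ℚ z *ℚ y
  swap = solve 3 (λ x y z → x :* y :* z := x :* z :* y) refl

below-threshold : ∀ {u v w} D N M → u *ℚ ℕtoℚ w ≡ ℕtoℚ v →
  ℕtoℚ N ≤ℚ invℕ (suc D) *ℚ u *ℚ ℕtoℚ M → N * (suc D * w) ≤ v * M
below-threshold {u} {v} {w} D N M uw≡v N≤t = ℕtoℚ-cancel-≤ $ begin
  ℕtoℚ (N * (suc D * w))                               ≡⟨ ℕtoℚ-* N (suc D * w) ⟩
  ℕtoℚ N *ℚ ℕtoℚ (suc D * w)
    ≤⟨ ℚ.*-monoʳ-≤-nonNeg (ℕtoℚ (suc D * w)) {{ℕtoℚ-nonNeg (suc D * w)}} N≤t ⟩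
  invℕ (suc D) *ℚ u *ℚ ℕtoℚ M *ℚ ℕtoℚ (suc D * w)
    ≡⟨ cong (invℕ (suc D) *ℚ u *ℚ ℕtoℚ M *ℚ_) (ℕtoℚ-* (suc D) w) ⟩
  invℕ (suc D) *ℚ u *ℚ ℕtoℚ M *ℚ (ℕtoℚ (suc D) *ℚ ℕtoℚ w)
    ≡⟨ regroup (invℕ (suc D)) u (ℕtoℚ M) (ℕtoℚ (suc D)) (ℕtoℚ w) ⟩
  invℕ (suc D) *ℚ ℕtoℚ (suc D) *ℚ (u *ℚ ℕtoℚ w *ℚ ℕtoℚ M)
    ≡⟨ cong₂ (λ x y → x *ℚ (y *ℚ ℕtoℚ M)) (invℕ-inverse (suc D)) uw≡v ⟩
  1ℚ *ℚ (ℕtoℚ v *ℚ ℕtoℚ M)                             ≡⟨ ℚ.*-identityˡ (ℕtoℚ v *ℚ ℕtoℚ M) ⟩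
  ℕtoℚ v *ℚ ℕtoℚ M                                     ≡⟨ ℕtoℚ-* v M ⟨
  ℕtoℚ (v * M)                                         ∎
  where
  open ℚ.≤-Reasoning
  open +-*-Solver
  regroup : ∀ i u m s w → i *ℚ u *ℚ m *ℚ (s *ℚ w) ≡ i *ℚ s *ℚ (u *ℚ w *ℚ m)
  regroup = solve 5 (λ i u m s w → i :* u :* m :* (s :* w) := i :* s :* (u :* w :* m)) refl

invℕ-below : ∀ {p} D Z E → 0 < Z → 9 ≤ D → Z ≤ 9 * E → p *ℚ ℕtoℚ Z ≡ ℕtoℚ E → invℕ (suc D) <ℚ p
invℕ-below {p} D Z E Z>0 9≤D Z≤9E pZ≡E = ℚ.*-cancelʳ-<-nonNeg (ℕtoℚ Z) {{ℕtoℚ-nonNeg Z}} $ begin-strict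
  invℕ (suc D) *ℚ ℕtoℚ Z
    <⟨ ℚ.*-monoʳ-<-pos (invℕ (suc D)) {{ℚ.normalize-pos 1 (suc D)}} (ℕtoℚ-mono-< Z<[1+D]E) ⟩
  invℕ (suc D) *ℚ ℕtoℚ (suc D * E)             ≡⟨ cong (invℕ (suc D) *ℚ_) (ℕtoℚ-* (suc D) E) ⟩
  invℕ (suc D) *ℚ (ℕtoℚ (suc D) *ℚ ℕtoℚ E)     ≡⟨ ℚ.*-assoc (invℕ (suc D)) (ℕtoℚ (suc D)) (ℕtoℚ E) ⟨
  invℕ (suc D) *ℚ ℕtoℚ (suc D) *ℚ ℕtoℚ E       ≡⟨ cong (_*ℚ ℕtoℚ E) (invℕ-inverse (suc D)) ⟩
  1ℚ *ℚ ℕtoℚ E                                 ≡⟨ ℚ.*-identityˡ (ℕtoℚ E) ⟩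
  ℕtoℚ E                                       ≡⟨ pZ≡E ⟨
  p *ℚ ℕtoℚ Z                                  ∎
  where
  open ℚ.≤-Reasoning
  E>0 : 0 < E
  E>0 = n≢0⇒n>0 λ { refl → <⇒≱ Z>0 (≤-trans Z≤9E (≤-reflexive (*-zeroʳ 9))) }
  Z<[1+D]E : Z < suc D * E
  Z<[1+D]E = ≤-<-trans Z≤9E (*-monoˡ-< E {{>-nonZero E>0}} (s≤s 9≤D))

selection-probability : ∀ {u v w} k .{{_ : NonZero k}} → u *ℚ ℕtoℚ w ≡ ℕtoℚ v →
  u *ℚ invℕ k *ℚ ℕtoℚ (w * k) ≡ ℕtoℚ v
selection-probability {u} {v} {w} k uw≡v = begin
  u *ℚ invℕ k *ℚ ℕtoℚ (w * k)              ≡⟨ cong (u *ℚ invℕ k *ℚ_) (ℕtoℚ-* w k) ⟩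
  u *ℚ invℕ k *ℚ (ℕtoℚ w *ℚ ℕtoℚ k)        ≡⟨ *ℚ-interchange u (invℕ k) (ℕtoℚ w) (ℕtoℚ k) ⟩
  u *ℚ ℕtoℚ w *ℚ (invℕ k *ℚ ℕtoℚ k)        ≡⟨ cong₂ _*ℚ_ uw≡v (invℕ-inverse k) ⟩
  ℕtoℚ v *ℚ 1ℚ                             ≡⟨ ℚ.*-identityʳ (ℕtoℚ v) ⟩
  ℕtoℚ v                                   ∎
  where
  open ≡-Reasoning

-- Since m^r ≤ 2^r·r!·C(m,r) for 2r ≤ m, at most u·C(m,r)/128 copies of K_r lie below δᵣ r·u·m^r.
Dᵣ : ℕ → ℕ
Dᵣ r = 128 * (2 ^ r * r !)

few-cliques : ∀ {r m v w} N → 2 * r ≤ m → N * (suc (Dᵣ r) * w) ≤ v * m ^ r → 128 * N * w ≤ v * (m C r)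
few-cliques {r} {m} {v} {w} N 2r≤m below = *-cancelʳ-≤ _ _ (2 ^ r * r !) {{m*n≢0 _ _ {{m^n≢0 2 r}} {{_!≢0 r}}}} (begin
  128 * N * w * ρ                   ≤⟨ m≤n+m _ (N * w) ⟩
  N * w + 128 * N * w * ρ           ≡⟨ expand N w ρ ⟩
  N * (suc (128 * ρ) * w)           ≤⟨ below ⟩
  v * m ^ r                         ≤⟨ *-monoʳ-≤ v (m^r≤2^r*r!*mCr r 2r≤m) ⟩
  v * (ρ * (m C r))                 ≡⟨ reorder v ρ (m C r) ⟩
  v * (m C r) * ρ                   ∎)
  where
  open ≤-Reasoning
  ρ = 2 ^ r * r !
  expand : ∀ N w ρ → N * w + 128 * N * w * ρ ≡ N * (suc (128 * ρ) * w)
  expand = solve-∀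
  reorder : ∀ v ρ c → v * (ρ * c) ≡ v * c * ρ
  reorder = solve-∀

powers-cancel-≤ : ∀ {v w m n r} .{{_ : NonZero w}} .{{_ : NonZero r}} → w ≤ v → v * m ^ r ≤ w * n ^ r → m ≤ n
powers-cancel-≤ {v} {w} {m} {n} {r} w≤v vm^r≤wn^r = ≮⇒≥ λ n<m → <⇒≱ (begin-strict
  w * n ^ r   <⟨ *-monoʳ-< w (^-monoˡ-< r n<m) ⟩
  w * m ^ r   ≤⟨ *-monoˡ-≤ (m ^ r) w≤v ⟩
  v * m ^ r   ∎) vm^r≤wn^r
  where open ≤-Reasoning

module RandomSelection (n m r v w : ℕ) .{{_ : NonZero w}} (w≤v : w ≤ v) (r≤m : r ≤ m) (m≤n : m ≤ n)
                       (v[mCr]≤w[nCr] : v * (m C r) ≤ w * (n C r)) where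

  open RandomCliqueGraph n m r public

  K : ℕ
  K = (n ∸ r) C (m ∸ r)

  instance
    L≢0 : NonZero L
    L≢0 = >-nonZero (subst (0 <_) (sym (length-mSubsets n m)) (nCk>0 m≤n))
    nCr≢0 : NonZero (n C r)
    nCr≢0 = >-nonZero (nCk>0 (≤-trans r≤m m≤n))
    mCr≢0 : NonZero (m C r)
    mCr≢0 = >-nonZero (nCk>0 r≤m)
    v≢0 : NonZero v
    v≢0 = >-nonZero (≤-trans (>-nonZero⁻¹ w) w≤v)

  Kv≤wL : K * v ≤ w * L
  Kv≤wL = *-cancelˡ-≤ (n C r) $ begin
    (n C r) * (K * v)     ≡⟨ *-assoc (n C r) K v ⟨
    (n C r) * K * v       ≡⟨ cong (_* v) (double-counting r≤m) ⟩
    L * (m C r) * v       ≡⟨ reorder L (m C r) v ⟩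
    L * (v * (m C r))     ≤⟨ *-monoʳ-≤ L v[mCr]≤w[nCr] ⟩
    L * (w * (n C r))     ≡⟨ reorder′ L w (n C r) ⟩
    (n C r) * (w * L)     ∎
    where
    open ≤-Reasoning
    reorder : ∀ L c v → L * c * v ≡ L * (v * c)
    reorder = solve-∀
    reorder′ : ∀ L w c → L * (w * c) ≡ c * (w * L)
    reorder′ = solve-∀

  v≤wL : v ≤ w * L
  v≤wL = ≤-trans (m≤n*m v K {{>-nonZero (nCk>0 (∸-monoˡ-≤ r m≤n))}}) Kv≤wL

  open Bernoulli (w * L ∸ v) v public

  [wL∸v]+v≡wL : w * L ∸ v + v ≡ w * L
  [wL∸v]+v≡wL = m∸n+n≡m v≤wL

  𝔼[w#selected] : 𝔼 (λ B → w * #selected B) ≡ v * mass {L}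
  𝔼[w#selected] = trans (𝔼-distribˡ-* w #selected) (*-cancelʳ-≡ (w * 𝔼 #selected) (v * mass {L}) L (begin
    w * 𝔼 #selected * L                        ≡⟨ x*y*z≡y*[x*z] w (𝔼 #selected) L ⟩
    𝔼 #selected * (w * L)                      ≡⟨ cong (𝔼 #selected *_) [wL∸v]+v≡wL ⟨
    𝔼 #selected * (w * L ∸ v + v)              ≡⟨ first-moment (full L) ⟩
    card (full L) * v * (w * L ∸ v + v) ^ L    ≡⟨ cong₂ (λ k z → k * v * z) (card-full L) (sym (mass≡ L)) ⟩
    L * v * mass {L}                           ≡⟨ x*y*z≡y*z*x L v (mass {L}) ⟩
    v * mass {L} * L                               ∎))
    where
    open ≡-Reasoning

  𝔼[w#selected]² : 𝔼 (λ B → w * #selected B * (w * #selected B)) ≤ 2 * (v * v) * mass {L}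
  𝔼[w#selected]² = ≤-trans (≤-reflexive (trans (𝔼-cong (λ B → square w (#selected B))) (𝔼-distribˡ-* (w * w) M²)))
    (*-cancelʳ-≤ _ _ (L * L) {{m*n≢0 L L}} (begin
      w * w * 𝔼 M² * (L * L)                           ≡⟨ regroup w (𝔼 M²) L ⟩
      𝔼 M² * ((w * L) * (w * L))                       ≡⟨ cong (λ b → 𝔼 M² * (b * b)) [wL∸v]+v≡wL ⟨
      𝔼 M² * ((w * L ∸ v + v) * (w * L ∸ v + v))       ≤⟨ second-moment-≤ (full L) ⟩
      (k * v * b + k * v * (k * v)) * b ^ L            ≡⟨ cong₂ (λ k z → (k * v * b + k * v * (k * v)) * z)
                                                                 (card-full L) (sym (mass≡ L)) ⟩
      (L * v * b + L * v * (L * v)) * mass {L}         ≡⟨ cong (λ b → (L * v * b + L * v * (L * v)) * mass {L}) [wL∸v]+v≡wL ⟩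
      (L * v * (w * L) + L * v * (L * v)) * mass {L}   ≡⟨ factor L v w (mass {L}) ⟩
      (v * w + v * v) * mass {L} * (L * L)
        ≤⟨ *-monoˡ-≤ (L * L) (*-monoˡ-≤ (mass {L}) (+-monoˡ-≤ (v * v) (*-monoʳ-≤ v w≤v))) ⟩
      (v * v + v * v) * mass {L} * (L * L)             ≡⟨ cong (λ x → x * mass {L} * (L * L)) (sym (2*x≡x+x (v * v))) ⟩
      2 * (v * v) * mass {L} * (L * L)                 ∎))
    where
    open ≤-Reasoning
    M² = λ B → #selected B * #selected B
    k = card (full L)
    b = w * L ∸ v + v
    square : ∀ w x → w * x * (w * x) ≡ w * w * (x * x)
    square = solve-∀
    regroup : ∀ w e L → w * w * e * (L * L) ≡ e * ((w * L) * (w * L))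
    regroup = solve-∀
    factor : ∀ L v w z → (L * v * (w * L) + L * v * (L * v)) * z ≡ (v * w + v * v) * z * (L * L)
    factor = solve-∀
    2*x≡x+x : ∀ x → 2 * x ≡ x + x
    2*x≡x+x = solve-∀

  coverage-second-moment : ∀ {S} → card S ≡ r →
    (w * L) * 𝔼 (λ B → coverage S B * coverage S B) ≤ 2 * K * v * mass {L}
  coverage-second-moment {S} card≡r = *-cancelʳ-≤ _ _ (w * L) {{m*n≢0 w L}} (begin
    (w * L) * 𝔼 Y² * (w * L)                     ≡⟨ cong (_* (w * L)) (*-comm (w * L) (𝔼 Y²)) ⟩
    𝔼 Y² * (w * L) * (w * L)                     ≡⟨ cong (λ b → 𝔼 Y² * b * b) [wL∸v]+v≡wL ⟨
    𝔼 Y² * b * b                                 ≡⟨ *-assoc (𝔼 Y²) b b ⟩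
    𝔼 Y² * (b * b)                               ≤⟨ second-moment-≤ χ ⟩
    (card χ * v * b + card χ * v * (card χ * v)) * b ^ L
                                                 ≡⟨ cong₂ (λ k z → (k * v * b + k * v * (k * v)) * z)
                                                          (card-containing-r-set S card≡r r≤m) (sym (mass≡ L)) ⟩
    (K * v * b + K * v * (K * v)) * mass {L}     ≤⟨ *-monoˡ-≤ (mass {L}) (+-monoʳ-≤ (K * v * b) (*-monoʳ-≤ (K * v) Kv≤b)) ⟩
    (K * v * b + K * v * b) * mass {L}           ≡⟨ double K v b (mass {L}) ⟩
    2 * K * v * mass {L} * b                     ≡⟨ cong (2 * K * v * mass {L} *_) [wL∸v]+v≡wL ⟩
    2 * K * v * mass {L} * (w * L)               ∎)
    where
    open ≤-Reasoning
    χ = containing S (cliqueSets n m)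
    Y² = λ B → coverage S B * coverage S B
    b = w * L ∸ v + v
    Kv≤b : K * v ≤ b
    Kv≤b = ≤-trans Kv≤wL (≤-reflexive (sym [wL∸v]+v≡wL))
    double : ∀ K v b z → (K * v * b + K * v * b) * z ≡ 2 * K * v * z * b
    double = solve-∀

  𝔼[w∑coverage²] : 𝔼 (λ B → w * ∑coverage² B) ≤ 2 * (m C r) * v * mass {L}
  𝔼[w∑coverage²] = ≤-trans (≤-reflexive (𝔼-distribˡ-* w ∑coverage²)) (*-cancelʳ-≤ _ _ L (begin
    w * 𝔼 ∑coverage² * L                               ≡⟨ x*y*z≡y*[x*z] w (𝔼 ∑coverage²) L ⟩
    𝔼 ∑coverage² * (w * L)
      ≡⟨ cong (_* (w * L)) (𝔼-∑ Ss (λ S B → coverage S B * coverage S B)) ⟩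
    ∑[ S ∈ Ss ] 𝔼 (λ B → coverage S B * coverage S B) * (w * L)
      ≡⟨ *-comm _ (w * L) ⟩
    (w * L) * ∑[ S ∈ Ss ] 𝔼 (λ B → coverage S B * coverage S B)
      ≡⟨ ∑-distribˡ-* Ss (w * L) _ ⟨
    ∑[ S ∈ Ss ] ((w * L) * 𝔼 (λ B → coverage S B * coverage S B))
      ≤⟨ ∑-monoᴬ (All.map (λ {S} → coverage-second-moment {S}) (mSubsets-card n r)) ⟩
    ∑[ S ∈ Ss ] (2 * K * v * mass {L})                 ≡⟨ ∑-const Ss _ ⟩
    length Ss * (2 * K * v * mass {L})                 ≡⟨ cong (_* (2 * K * v * mass {L})) (length-mSubsets n r) ⟩
    (n C r) * (2 * K * v * mass {L})                   ≡⟨ pull-out (n C r) K v (mass {L}) ⟩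
    2 * v * mass {L} * ((n C r) * K)                   ≡⟨ cong (2 * v * mass {L} *_) (double-counting r≤m) ⟩
    2 * v * mass {L} * (L * (m C r))                   ≡⟨ push-in v (mass {L}) L (m C r) ⟩
    2 * (m C r) * v * mass {L} * L                     ∎))
    where
    open ≤-Reasoning
    Ss = mSubsets n r
    pull-out : ∀ c K v z → c * (2 * K * v * z) ≡ 2 * v * z * (c * K)
    pull-out = solve-∀
    push-in : ∀ v z L c → 2 * v * z * (L * c) ≡ 2 * c * v * z * L
    push-in = solve-∀

  many-cliques-likely : (θ : Vec Bool L → Bool) →
    (∀ B → θ B ≡ false → 128 * numKr r (G B) * w ≤ v * (m C r)) →
    mass {L} ≤ 9 * 𝔼 (𝟙 ∘ θ)
  many-cliques-likely θ few⇒¬θ =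
    likely-by-second-moment {c = m C r} {v} {μ} {ξ} {κ} θ 3cμ≤2ξ+κ ξ≤cμ few
      𝔼[w#selected] 𝔼[w#selected]² 𝔼[w∑coverage²]
    where
    open ≤-Reasoning
    μ ξ κ : Vec Bool L → ℕ
    μ B = w * #selected B
    ξ B = w * #covered B
    κ B = w * ∑coverage² B
    3cμ≤2ξ+κ : ∀ B → 3 * (m C r) * μ B ≤ 2 * ξ B + κ B
    3cμ≤2ξ+κ B = begin
      3 * (m C r) * (w * #selected B)         ≡⟨ pull-w w (m C r) (#selected B) ⟩
      w * (3 * (m C r) * #selected B)         ≤⟨ *-monoʳ-≤ w (3*mCr*#selected≤2*#covered+∑coverage² B) ⟩
      w * (2 * #covered B + ∑coverage² B)     ≡⟨ push-w w (#covered B) (∑coverage² B) ⟩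
      2 * (w * #covered B) + w * ∑coverage² B ∎
      where
      pull-w : ∀ w c x → 3 * c * (w * x) ≡ w * (3 * c * x)
      pull-w = solve-∀
      push-w : ∀ w x q → w * (2 * x + q) ≡ 2 * (w * x) + w * q
      push-w = solve-∀
    ξ≤cμ : ∀ B → ξ B ≤ (m C r) * μ B
    ξ≤cμ B = ≤-trans (*-monoʳ-≤ w (#covered≤mCr*#selected B)) (≤-reflexive (x*[y*z]≡y*[x*z] w (m C r) (#selected B)))
    few : ∀ B → θ B ≡ false → 128 * ξ B ≤ v * (m C r)
    few B ¬θ = begin
      128 * (w * #covered B)            ≤⟨ *-monoʳ-≤ 128 (*-monoʳ-≤ w (#covered≤#Kr B)) ⟩
      128 * (w * numKr r (G B))         ≡⟨ reorder (numKr r (G B)) w ⟩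
      128 * numKr r (G B) * w           ≤⟨ few⇒¬θ B ¬θ ⟩
      v * (m C r)                       ∎
      where
      reorder : ∀ N w → 128 * (w * N) ≡ 128 * N * w
      reorder = solve-∀

  mass>0 : 0 < mass {L}
  mass>0 = subst (0 <_) (sym (mass≡ L)) (m^n>0 (w * L ∸ v + v) {{b≢0}} L)
    where
    b≢0 : NonZero (w * L ∸ v + v)
    b≢0 = subst NonZero (sym [wL∸v]+v≡wL) (m*n≢0 w L)

  exceeds : ℚ → Vec Bool L → Bool
  exceeds t B = not (ℕtoℚ (numKr r (G B)) ℚ.≤ᵇ t)

  ¬exceeds⇒≤ : ∀ {t} B → exceeds t B ≡ false → ℕtoℚ (numKr r (G B)) ≤ℚ t
  ¬exceeds⇒≤ {t} B ¬exceeds = ℚ.≤ᵇ⇒≤ {ℕtoℚ (numKr r (G B))} {t} (not≡false⇒T ¬exceeds)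
    where
    not≡false⇒T : ∀ {b} → not b ≡ false → T b
    not≡false⇒T {true} _ = tt

  probKrExceeds-scaled : ∀ {u} t → u *ℚ ℕtoℚ w ≡ ℕtoℚ v →
    probKrExceeds u m n r t *ℚ ℕtoℚ (mass {L}) ≡ ℕtoℚ (𝔼 (𝟙 ∘ exceeds t))
  probKrExceeds-scaled {u} t uw≡v =
    trans (cong (λ z → probKrExceeds u m n r t *ℚ ℕtoℚ z) (mass≡ L)) (prob-scaled L (exceeds t))
    where
    p[d+a]≡a : u *ℚ invℕ (n C m) *ℚ ℕtoℚ (w * L ∸ v + v) ≡ ℕtoℚ v
    p[d+a]≡a = trans (cong₂ (λ k b → u *ℚ invℕ k *ℚ ℕtoℚ b) (sym (length-mSubsets n m)) [wL∸v]+v≡wL)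
                     (selection-probability {u} {v} {w} L uw≡v)
    open BernoulliWeights (w * L ∸ v) v (u *ℚ invℕ (n C m)) p[d+a]≡a using (prob-scaled)

δᵣ : ℕ → ℚ
δᵣ r = invℕ (suc (Dᵣ r))

δᵣ<probKrExceeds : ∀ {r u v w} m n .{{_ : NonZero r}} .{{_ : NonZero w}} → w ≤ v → u *ℚ ℕtoℚ w ≡ ℕtoℚ v →
  2 * r ≤ m → u *ℚ ℕtoℚ (m ^ r) ≤ℚ ℕtoℚ (n ^ r) →
  δᵣ r <ℚ probKrExceeds u m n r (δᵣ r *ℚ u *ℚ ℕtoℚ (m ^ r))
δᵣ<probKrExceeds {r} {u} {v} {w} m n w≤v uw≡v 2r≤m um^r≤n^r =
  invℕ-below (Dᵣ r) (mass {L}) (𝔼 (𝟙 ∘ exceeds t)) mass>0 9≤D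
    (many-cliques-likely (exceeds t) few) (probKrExceeds-scaled {u} t uw≡v)
  where
  t = δᵣ r *ℚ u *ℚ ℕtoℚ (m ^ r)
  9≤D : 9 ≤ Dᵣ r
  9≤D = ≤-trans (m≤m+n 9 119) (m≤m*n 128 (2 ^ r * r !) {{m*n≢0 _ _ {{m^n≢0 2 r}} {{_!≢0 r}}}})
  vm^r≤wn^r : v * m ^ r ≤ w * n ^ r
  vm^r≤wn^r = clear-denominator-≤ {u} {v} {w} {m ^ r} {n ^ r} uw≡v um^r≤n^r
  r≤m : r ≤ m
  r≤m = ≤-trans (m≤m+n r (r + 0)) 2r≤m
  m≤n : m ≤ n
  m≤n = powers-cancel-≤ w≤v vm^r≤wn^r
  instance
    n≢0 : NonZero n
    n≢0 = >-nonZero (≤-trans (≤-trans (>-nonZero⁻¹ r) r≤m) m≤n)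
  open RandomSelection n m r v w w≤v r≤m m≤n (v*m^r≤w*n^r⇒v*mCr≤w*nCr {v} {w} r≤m m≤n vm^r≤wn^r)
  few : ∀ B → exceeds t B ≡ false → 128 * numKr r (G B) * w ≤ v * (m C r)
  few B ¬exceeds = few-cliques {r} {m} {v} {w} (numKr r (G B)) 2r≤m
    (below-threshold {u} {v} {w} (Dᵣ r) (numKr r (G B)) (m ^ r) uw≡v (¬exceeds⇒≤ B ¬exceeds))

lemma3p1 : (r : ℕ) → 2 ≤ r →
    Σ ℚ (λ δ → (0ℚ <ℚ δ) ×
      ((u : ℚ) (m n : ℕ) → 1ℚ ≤ℚ u → 2 * r ≤ m → (u *ℚ ℕtoℚ (m ^ r)) ≤ℚ ℕtoℚ (n ^ r) →
        δ <ℚ probKrExceeds u m n r (δ *ℚ u *ℚ ℕtoℚ (m ^ r))))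
lemma3p1 r 2≤r = δᵣ r , invℕ-pos (Dᵣ r) , λ u m n 1≤u →
  let v , w , w≢0 , w≤v , uw≡v = ratio-of-naturals 1≤u
  in δᵣ<probKrExceeds {r} {u} {v} {w} m n {{>-nonZero (≤-trans (s≤s z≤n) 2≤r)}} {{w≢0}} w≤v uw≡v
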